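{- Let $\Sigma=(\Gamma,\sigma)$ be a signed graph and let $\nu$ be the number of negative edges of $\Sigma$. Then in each of $\mathsf E(\Sigma,x,y)$ and $\mathsf O(\Sigma,x,y)$, the coefficient of $x^{|V(\Gamma)|-1}$ equals $-|E(\Gamma)|$ and the coefficient of $x^{|V(\Gamma)|-2}y$ equals $\nu$. Moreover, if $\Sigma$ is all-positive, then $\mathsf E(\Sigma,x,y)=\mathsf O(\Sigma,x,y)=\mathsf E(\Sigma,x)=\mathsf O(\Sigma,x)=\chi(\Gamma,x)$.
   Context: A signed graph $\Sigma=(\Gamma,\sigma)$ is a finite simple graph $\Gamma$ with a signature $\sigma:E(\Gamma)\to\{\pm1\}$; it is all-positive if all edges have sign $+1$. $\chi(\Gamma,x)$ is the usual chromatic polynomial of $\Gamma$. For a finite $C\subseteq\mathbb Z$, a proper $C$-colouring of $\Sigma$ is a map $\kappa:V(\Gamma)\to C$ with $\kappa(v)\ne\sigma(\{v,w\})\kappa(w)$ for every edge $\{v,w\}$. Univariate: for $\lambda\ge0$, $C_\lambda$ is the set of nonzero integers in $[-\lambda/2,\lambda/2]$ if $\lambda$ is even and the set of integers in $[-(\lambda-1)/2,(\lambda-1)/2]$ if $\lambda$ is odd; $f(\Sigma,\lambda)$ is the number of proper $C_\lambda$-colourings; $\mathsf E(\Sigma,x),\mathsf O(\Sigma,x)\in\mathbb Z[x]$ are the unique polynomials with $f(\Sigma,\lambda)=\mathsf E(\Sigma,\lambda)$ for even $\lambda\ge0$ and $=\mathsf O(\Sigma,\lambda)$ for odd $\lambda\ge0$.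 Bivariate: for integers $\lambda\ge\mu\ge0$, a finite $C\subseteq\mathbb Z$ is a $(\lambda,\mu)$-colour set if there are disjoint sets $P,U$ of nonzero integers with $-P=P$, $|U|=\mu$, $(-U)\cap U=\varnothing$, and either $\lambda-\mu$ even, $|P|=\lambda-\mu$, $C=P\cup U$, or $\lambda-\mu$ odd, $|P|=\lambda-\mu-1$, $C=P\cup U\cup\{0\}$. $f(\Sigma,\lambda,\mu)$ is the number of proper $C$-colourings for any $(\lambda,\mu)$-colour set $C$ (independent of $C$). $\mathsf E(\Sigma,x,y),\mathsf O(\Sigma,x,y)\in\mathbb Z[x,y]$ are the unique polynomials with $f(\Sigma,\lambda,\mu)=\mathsf E(\Sigma,\lambda,\mu)$ for all integers $\lambda\ge\mu\ge0$ with $\lambda-\mu$ even and $f(\Sigma,\lambda,\mu)=\mathsf O(\Sigma,\lambda,\mu)$ whenever $\lambda-\mu$ is odd. -}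

module Defs where

open import Data.Nat as ℕ using (ℕ; zero; suc)
open import Data.Integer as ℤ using (ℤ; +_; -_; _+_; _*_; _^_)
open import Data.Bool using (Bool; true; false; _∧_; not; if_then_else_)
open import Data.Fin using (Fin; toℕ)
open import Data.Fin.Properties using () renaming (_≟_ to _≟ᶠ_)
open import Data.List using (List; []; _∷_; _++_; map; concatMap; length; filter; upTo; allFin)
open import Data.Bool.ListAction using (all)
open import Data.List.Membership.Propositional using (_∈_; _∉_)
open import Data.List.Relation.Unary.All using (All)
open import Data.List.Relation.Unary.Unique.Propositional using (Unique)
open import Data.List.Relation.Binary.Permutation.Propositional using (_↭_)
open import Data.Vec using (Vec; lookup) renaming ([] to []ᵥ; _∷_ to _∷ᵥ_)
open import Data.Product using (Σ; ∃; _×_; _,_)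
open import Data.Sum using (_⊎_)
open import Relation.Nullary using (¬_)
open import Relation.Nullary.Decidable using (⌊_⌋)
open import Relation.Binary.PropositionalEquality using (_≡_)

-- Signed graphs: finite simple graphs on vertex set Fin n, with a
-- signature on the edges (pos i j = true means sign +1, false means -1).

record SignedGraph : Set where
  field
    n          : ℕ
    adj        : Fin n → Fin n → Bool
    pos        : Fin n → Fin n → Bool
    adj-sym    : ∀ i j → adj i j ≡ adj j i
    adj-irrefl : ∀ i → adj i i ≡ false
    pos-sym    : ∀ i j → adj i j ≡ true → pos i j ≡ pos j i

open SignedGraph public

sgn : Bool → ℤ
sgn true  = + 1
sgn false = - (+ 1)

pairs< : (n : ℕ) → List (Fin n × Fin n)
pairs< n = concatMap (λ i → map (λ j → (i , j))
             (filter (λ j → toℕ i ℕ.<? toℕ j) (allFin n))) (allFin n)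

pairs : (n : ℕ) → List (Fin n × Fin n)
pairs n = concatMap (λ i → map (λ j → (i , j)) (allFin n)) (allFin n)

count : {A : Set} → (A → Bool) → List A → ℕ
count p []       = 0
count p (x ∷ xs) = if p x then suc (count p xs) else count p xs

numEdges : SignedGraph → ℕ
numEdges S = count (λ { (i , j) → adj S i j }) (pairs< (n S))

numNegEdges : SignedGraph → ℕ
numNegEdges S = count (λ { (i , j) → adj S i j ∧ not (pos S i j) }) (pairs< (n S))

AllPositive : SignedGraph → Set
AllPositive S = ∀ i j → adj S i j ≡ true → pos S i j ≡ true

allMaps : {A : Set} → List A → (n : ℕ) → List (Vec A n)
allMaps C zero    = []ᵥ ∷ []
allMaps C (suc n) = concatMap (λ c → map (c ∷ᵥ_) (allMaps C n)) C

properSigned : (S : SignedGraph) → Vec ℤ (n S) → Bool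
properSigned S κ = all (λ { (i , j) →
  not (adj S i j) Data.Bool.∨
  not ⌊ lookup κ i ℤ.≟ sgn (pos S i j) * lookup κ j ⌋ }) (pairs (n S))

-- number of proper C-colourings of Σ (C a duplicate-free list of colours)
numColourings : SignedGraph → List ℤ → ℕ
numColourings S C = count (properSigned S) (allMaps C (n S))

properOrd : (S : SignedGraph) → Vec ℕ (n S) → Bool
properOrd S κ = all (λ { (i , j) →
  not (adj S i j) Data.Bool.∨ not ⌊ lookup κ i ℕ.≟ lookup κ j ⌋ }) (pairs (n S))

numOrdColourings : SignedGraph → ℕ → ℕ
numOrdColourings S k = count (properOrd S) (allMaps (upTo k) (n S))

pmList : ℕ → List ℤ
pmList zero    = []
pmList (suc k) = + (suc k) ∷ - (+ (suc k)) ∷ pmList k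

-- C_{2k} = {±1..±k},  C_{2k+1} = {0} ∪ {±1..±k}
Cλ : ℕ → List ℤ
Cλ λ' = go λ'
  where
  half : ℕ → ℕ
  half zero = zero
  half (suc zero) = zero
  half (suc (suc m)) = suc (half m)
  isEven : ℕ → Bool
  isEven zero = true
  isEven (suc zero) = false
  isEven (suc (suc m)) = isEven m
  go : ℕ → List ℤ
  go m = if isEven m then pmList (half m) else (+ 0) ∷ pmList (half m)

f₁ : SignedGraph → ℕ → ℕ
f₁ S λ' = numColourings S (Cλ λ')

NonZero : ℤ → Set
NonZero z = ¬ (z ≡ + 0)

IsColourSet : ℕ → ℕ → List ℤ → Set
IsColourSet λ' μ C =
  Σ (List ℤ) λ P → Σ (List ℤ) λ U →
    Unique P × Unique U ×
    All NonZero P × All NonZero U ×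
    (∀ x → x ∈ P → - x ∈ P) ×
    (∀ x → x ∈ P → x ∉ U) ×
    length U ≡ μ ×
    (∀ x → x ∈ U → - x ∉ U) ×
    ( (Σ ℕ λ k → λ' ≡ μ ℕ.+ 2 ℕ.* k × length P ≡ 2 ℕ.* k × C ↭ P ++ U)
    ⊎ (Σ ℕ λ k → λ' ≡ μ ℕ.+ suc (2 ℕ.* k) × length P ≡ 2 ℕ.* k × C ↭ (+ 0) ∷ P ++ U))

-- univariate: coefficient list, constant term first
Poly₁ : Set
Poly₁ = List ℤ

nth : List ℤ → ℕ → ℤ
nth []       _       = + 0
nth (c ∷ cs) zero    = c
nth (c ∷ cs) (suc i) = nth cs i

coeff₁ : Poly₁ → ℕ → ℤ
coeff₁ = nth

eval₁ : Poly₁ → ℤ → ℤ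
eval₁ []       x = + 0
eval₁ (c ∷ cs) x = c + x * eval₁ cs x

-- bivariate: entry i is the polynomial in y multiplying x^i
Poly₂ : Set
Poly₂ = List (List ℤ)

coeff₂ : Poly₂ → ℕ → ℕ → ℤ
coeff₂ []       i       j = + 0
coeff₂ (p ∷ ps) zero    j = nth p j
coeff₂ (p ∷ ps) (suc i) j = coeff₂ ps i j

eval₂ : Poly₂ → ℤ → ℤ → ℤ
eval₂ []       x y = + 0
eval₂ (p ∷ ps) x y = eval₁ p y + x * eval₂ ps x y

IsE₂ : SignedGraph → Poly₂ → Set
IsE₂ S P = ∀ λ' μ k C → λ' ≡ μ ℕ.+ 2 ℕ.* k → IsColourSet λ' μ C →
  + numColourings S C ≡ eval₂ P (+ λ') (+ μ)

IsO₂ : SignedGraph → Poly₂ → Set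
IsO₂ S P = ∀ λ' μ k C → λ' ≡ μ ℕ.+ suc (2 ℕ.* k) → IsColourSet λ' μ C →
  + numColourings S C ≡ eval₂ P (+ λ') (+ μ)

IsE₁ : SignedGraph → Poly₁ → Set
IsE₁ S P = ∀ k → + f₁ S (2 ℕ.* k) ≡ eval₁ P (+ (2 ℕ.* k))

IsO₁ : SignedGraph → Poly₁ → Set
IsO₁ S P = ∀ k → + f₁ S (suc (2 ℕ.* k)) ≡ eval₁ P (+ suc (2 ℕ.* k))

IsChrom : SignedGraph → Poly₁ → Set
IsChrom S P = ∀ k → + numOrdColourings S k ≡ eval₁ P (+ k)

_≈₂_ : Poly₂ → Poly₂ → Set
P ≈₂ Q = ∀ i j → coeff₂ P i j ≡ coeff₂ Q i j

_≈₁_ : Poly₁ → Poly₁ → Set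
P ≈₁ Q = ∀ i → coeff₁ P i ≡ coeff₁ Q i

embed : Poly₁ → Poly₂
embed = map (λ c → c ∷ [])

LeadingCoeffs : SignedGraph → Poly₂ → Set
LeadingCoeffs S P =
  (∀ m → n S ≡ suc m → coeff₂ P m 0 ≡ - (+ numEdges S)) ×
  (∀ m → n S ≡ suc (suc m) → coeff₂ P m 1 ≡ + numNegEdges S)

{-# OPTIONS --safe #-}

-- Deletion–contraction is run on a more general problem: colouring a system of constraints
-- κ i ≢ ±κ j in which every vertex carries a domain saying whether it may take the colour 0,
-- a colour c with -c ∈ C, or one with -c ∉ C.  Deleting a constraint and subtracting its
-- contraction (κ i replaced by ±κ j, shrinking the domain of j) ends in products of domain
-- sizes, and for a (λ, μ)-colour set each size is a linear polynomial in λ and μ depending only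
-- on the parity of λ - μ.  This gives E and O; their values at infinitely many admissible points
-- make them unique.  Contraction removes a vertex, so in total degree ≥ n - 1 only the first
-- round survives: xⁿ minus xⁿ⁻¹ for each positive edge and xⁿ⁻¹ - xⁿ⁻²y for each negative one.
-- If all edges are positive every domain stays full, only |C| = λ matters, and all five
-- polynomials reduce to the chromatic polynomial.

module Submission where

open import Defs
open import Algebra.Properties.CommutativeSemigroup using (interchange)
open import Data.Bool using (Bool; true; false; _∧_; _∨_; not; if_then_else_; T)
import Data.Bool.Properties as BP
open import Data.Bool.ListAction using (all; and)
open import Data.Fin as F using (Fin; toℕ; punchIn; punchOut)
import Data.Fin.Properties as FP
open import Data.Integer as ℤ using (ℤ; +_; -_; _+_; _*_; _-_; _^_; ∣_∣)
import Data.Integer.Properties as ℤP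
open import Data.Integer.Solver using (module +-*-Solver)
open import Data.List as L using (List; []; _∷_; _++_; length; applyUpTo; upTo; filter; filterᵇ; allFin; concatMap)
import Data.List.Properties as LP
open import Data.List.Membership.DecPropositional ℤ._≟_ using (_∈?_)
open import Data.List.Membership.Propositional using (_∈_; _∉_; lose; find)
import Data.List.Membership.Propositional.Properties as ∈P
open import Data.List.Relation.Binary.Permutation.Propositional as ↭ using (_↭_; ↭⇒↭ₛ)
import Data.List.Relation.Binary.Permutation.Propositional.Properties as ↭P
open import Data.List.Relation.Unary.All as All using (All; []; _∷_)
import Data.List.Relation.Unary.All.Properties as AllP
open import Data.List.Relation.Unary.AllPairs as AllPairs using (AllPairs; []; _∷_)
import Data.List.Relation.Unary.AllPairs.Properties as AllPairsP
open import Data.List.Relation.Unary.Any using (here; there)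
open import Data.List.Relation.Unary.Unique.Propositional using (Unique)
import Data.List.Relation.Unary.Unique.Propositional.Properties as UniqueP
open import Data.Nat as ℕ using (ℕ; zero; suc; z≤n; s≤s)
import Data.Nat.Properties as ℕP
open import Data.Product using (Σ; ∃; _×_; _,_; proj₁; proj₂)
open import Data.Sum using (_⊎_; inj₁; inj₂)
open import Data.Vec as V using (Vec; lookup; insertAt) renaming ([] to []ᵥ; _∷_ to _∷ᵥ_)
import Data.Vec.Properties as VP
open import Data.Vec.Functional using (Vector; updateAt; removeAt; head; tail; foldr)
open import Data.Vec.Functional.Properties using (updateAt-updates; updateAt-minimal)
open import Data.Vec.Relation.Unary.All as Allᵥ using () renaming ([] to []ᵥ; _∷_ to _∷ᵥ_)
import Data.Vec.Relation.Unary.All.Properties as AllᵥP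
open import Data.Vec.Relation.Unary.AllPairs as AllPairsᵥ using () renaming ([] to []ᵥ; _∷_ to _∷ᵥ_)
open import Function using (_∘_; _∘′_)
open import Function.Bundles using (_⇔_; mk⇔; Equivalence)
open import Relation.Binary.Definitions using (tri<; tri≈; tri>)
open import Relation.Binary.PropositionalEquality
  using (setoid; _≡_; _≢_; refl; sym; trans; cong; cong₂; subst; module ≡-Reasoning)
open import Relation.Nullary using (¬_; yes; no; does; contradiction)
open import Relation.Nullary.Decidable using (⌊_⌋; T?; dec-true; dec-false; isYes≗does; does-⇔)
open import Data.List.Relation.Binary.Permutation.Setoid.Properties (setoid ℤ) using (Unique-resp-↭; foldr-commMonoid)

open +-*-Solver using (solve; _:=_; con; _:+_; _:*_; _:-_; :-_)


-- Polynomials and interpolation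

infixl 6 _⊖_

_⊖_ : Poly₁ → Poly₁ → Poly₁
[]       ⊖ []       = []
(p ∷ ps) ⊖ []       = p ∷ (ps ⊖ [])
[]       ⊖ (q ∷ qs) = - q ∷ ([] ⊖ qs)
(p ∷ ps) ⊖ (q ∷ qs) = p - q ∷ (ps ⊖ qs)

nth-⊖ : ∀ P Q i → nth (P ⊖ Q) i ≡ nth P i - nth Q i
nth-⊖ []       []       i       = refl
nth-⊖ (p ∷ ps) []       zero    = sym (ℤP.+-identityʳ p)
nth-⊖ (p ∷ ps) []       (suc i) = nth-⊖ ps [] i
nth-⊖ []       (q ∷ qs) zero    = sym (ℤP.+-identityˡ (- q))
nth-⊖ []       (q ∷ qs) (suc i) = nth-⊖ [] qs i
nth-⊖ (p ∷ ps) (q ∷ qs) zero    = refl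
nth-⊖ (p ∷ ps) (q ∷ qs) (suc i) = nth-⊖ ps qs i

eval-⊖ : ∀ P Q x → eval₁ (P ⊖ Q) x ≡ eval₁ P x - eval₁ Q x
eval-⊖ []       []       x = refl
eval-⊖ (p ∷ ps) []       x = trans (cong (λ e → p + x * e) (eval-⊖ ps [] x))
  (solve 3 (λ p x e → p :+ x :* (e :- con (+ 0)) := p :+ x :* e :- con (+ 0)) refl p x (eval₁ ps x))
eval-⊖ []       (q ∷ qs) x = trans (cong (λ e → - q + x * e) (eval-⊖ [] qs x))
  (solve 3 (λ q x e → :- q :+ x :* (con (+ 0) :- e) := con (+ 0) :- (q :+ x :* e)) refl q x (eval₁ qs x))
eval-⊖ (p ∷ ps) (q ∷ qs) x = trans (cong (λ e → p - q + x * e) (eval-⊖ ps qs x))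
  (solve 5 (λ p q x e f → p :- q :+ x :* (e :- f) := p :+ x :* e :- (q :+ x :* f))
         refl p q x (eval₁ ps x) (eval₁ qs x))

quotient : ℤ → Poly₁ → Poly₁
quotient r []           = []
quotient r (c ∷ [])     = []
quotient r (c ∷ c' ∷ cs) = eval₁ (c' ∷ cs) r ∷ quotient r (c' ∷ cs)

eval-quotient : ∀ r P x → eval₁ P x ≡ eval₁ P r + (x - r) * eval₁ (quotient r P) x
eval-quotient r []            x =
  solve 2 (λ x r → con (+ 0) := con (+ 0) :+ (x :- r) :* con (+ 0)) refl x r
eval-quotient r (c ∷ [])      x =
  solve 3 (λ c x r → c :+ x :* con (+ 0) := c :+ r :* con (+ 0) :+ (x :- r) :* con (+ 0)) refl c x r
eval-quotient r (c ∷ c' ∷ cs) x = begin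
  c + x * eval₁ (c' ∷ cs) x                  ≡⟨ cong (λ e → c + x * e) (eval-quotient r (c' ∷ cs) x) ⟩
  c + x * (E r + (x - r) * eval₁ Q x)        ≡⟨ solve 5 (λ c x r e q → c :+ x :* (e :+ (x :- r) :* q)
                                                    := c :+ r :* e :+ (x :- r) :* (e :+ x :* q))
                                                    refl c x r (E r) (eval₁ Q x) ⟩
  c + r * E r + (x - r) * (E r + x * eval₁ Q x) ∎
  where
  open ≡-Reasoning
  E = eval₁ (c' ∷ cs)
  Q = quotient r (c' ∷ cs)

length-quotient : ∀ r c cs → length (quotient r (c ∷ cs)) ≡ length cs
length-quotient r c []        = refl
length-quotient r c (c' ∷ cs) = cong suc (length-quotient r c' cs)

private
  c+r*0≡0 : ∀ {c} r → c + r * + 0 ≡ + 0 → c ≡ + 0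
  c+r*0≡0 {c} r e = trans (solve 2 (λ c r → c := c :+ r :* con (+ 0)) refl c r) e

quotient≈0⇒≈0 : ∀ r P → (∀ i → nth (quotient r P) i ≡ + 0) → eval₁ P r ≡ + 0 → ∀ i → nth P i ≡ + 0
quotient≈0⇒≈0 r []            hq hr i       = refl
quotient≈0⇒≈0 r (c ∷ [])      hq hr zero    = c+r*0≡0 r hr
quotient≈0⇒≈0 r (c ∷ [])      hq hr (suc i) = refl
quotient≈0⇒≈0 r (c ∷ c' ∷ cs) hq hr zero    = c+r*0≡0 r (subst (λ e → c + r * e ≡ + 0) (hq zero) hr)
quotient≈0⇒≈0 r (c ∷ c' ∷ cs) hq hr (suc i) = quotient≈0⇒≈0 r (c' ∷ cs) (λ i → hq (suc i)) (hq zero) i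

private
  nonzero-* : ∀ {a b} → a ≢ + 0 → b ≢ + 0 → a * b ≢ + 0
  nonzero-* {a} a≢0 b≢0 ab≡0 with ℤP.i*j≡0⇒i≡0∨j≡0 a ab≡0
  ... | inj₁ a≡0 = a≢0 a≡0
  ... | inj₂ b≡0 = b≢0 b≡0

-- Dividing by x - a moves the progression a, a + d, a + 2d, … one step.
vanishing-on-progression′ : ∀ N P → length P ℕ.≤ N → ∀ a d → d ≢ + 0 →
  (∀ k → eval₁ P (a + d * + k) ≡ + 0) → ∀ i → nth P i ≡ + 0
vanishing-on-progression′ N       []       _            a d d≢0 hP i = refl
vanishing-on-progression′ (suc N) (c ∷ cs) (ℕ.s≤s |cs|≤N) a d d≢0 hP =
  quotient≈0⇒≈0 a (c ∷ cs) Q≈0 Pa≡0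
  where
  open ≡-Reasoning
  Q = quotient a (c ∷ cs)
  P = c ∷ cs
  Pa≡0 : eval₁ P a ≡ + 0
  Pa≡0 = trans (cong (eval₁ P) (solve 2 (λ a d → a := a :+ d :* con (+ 0)) refl a d)) (hP 0)
  hQ : ∀ k → eval₁ Q ((a + d) + d * + k) ≡ + 0
  hQ k with ℤP.i*j≡0⇒i≡0∨j≡0 (d * + suc k) step
    where
    x = a + d * + suc k
    step : d * + suc k * eval₁ Q ((a + d) + d * + k) ≡ + 0
    step = begin
      d * + suc k * eval₁ Q ((a + d) + d * + k)
        ≡⟨ cong₂ (λ u v → u * eval₁ Q v)
             (solve 3 (λ a d k → d :* (con (+ 1) :+ k) := a :+ d :* (con (+ 1) :+ k) :- a) refl a d (+ k))
             (solve 3 (λ a d k → a :+ d :+ d :* k := a :+ d :* (con (+ 1) :+ k)) refl a d (+ k)) ⟩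
      (x - a) * eval₁ Q x                         ≡⟨ ℤP.+-identityˡ _ ⟨
      + 0 + (x - a) * eval₁ Q x                   ≡⟨ cong (λ u → u + (x - a) * eval₁ Q x) (sym Pa≡0) ⟩
      eval₁ P a + (x - a) * eval₁ Q x             ≡⟨ sym (eval-quotient a P x) ⟩
      eval₁ P x                                   ≡⟨ hP (suc k) ⟩
      + 0                                         ∎
  ... | inj₁ dk≡0 = contradiction dk≡0 (nonzero-* d≢0 (λ ()))
  ... | inj₂ Qx≡0 = Qx≡0
  Q≈0 : ∀ i → nth Q i ≡ + 0
  Q≈0 = vanishing-on-progression′ N Q (subst (ℕ._≤ N) (sym (length-quotient a c cs)) |cs|≤N) (a + d) d d≢0 hQ

vanishing-on-progression : ∀ P a d → d ≢ + 0 → (∀ k → eval₁ P (a + d * + k) ≡ + 0) → ∀ i → nth P i ≡ + 0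
vanishing-on-progression P = vanishing-on-progression′ (length P) P ℕP.≤-refl

≈₁-on-progression : ∀ P Q a d → d ≢ 0 → (∀ k → eval₁ P (+ (a ℕ.+ d ℕ.* k)) ≡ eval₁ Q (+ (a ℕ.+ d ℕ.* k))) → P ≈₁ Q
≈₁-on-progression P Q a d d≢0 h i = ℤP.i-j≡0⇒i≡j _ _ (trans (sym (nth-⊖ P Q i))
  (vanishing-on-progression (P ⊖ Q) (+ a) (+ d) (d≢0 ∘ ℤP.+-injective) (λ k → begin
    eval₁ (P ⊖ Q) (+ a + + d * + k)                           ≡⟨ eval-⊖ P Q _ ⟩
    eval₁ P (+ a + + d * + k) - eval₁ Q (+ a + + d * + k)     ≡⟨ cong (λ x → eval₁ P x - eval₁ Q x) point ⟨
    eval₁ P (+ (a ℕ.+ d ℕ.* k)) - eval₁ Q (+ (a ℕ.+ d ℕ.* k)) ≡⟨ ℤP.i≡j⇒i-j≡0 (h k) ⟩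
    + 0                                                       ∎) i))
  where
  open ≡-Reasoning
  point : ∀ {k} → + (a ℕ.+ d ℕ.* k) ≡ + a + + d * + k
  point {k} = trans (ℤP.pos-+ a (d ℕ.* k)) (cong (λ e → + a + e) (ℤP.pos-* d k))

restrictY : Poly₂ → ℤ → Poly₁
restrictY P y = L.map (λ p → eval₁ p y) P

eval-restrictY : ∀ P x y → eval₁ (restrictY P y) x ≡ eval₂ P x y
eval-restrictY []       x y = refl
eval-restrictY (p ∷ ps) x y = cong (λ e → eval₁ p y + x * e) (eval-restrictY ps x y)

row : Poly₂ → ℕ → Poly₁
row []       i       = []
row (p ∷ ps) zero    = p
row (p ∷ ps) (suc i) = row ps i

coeff₂-row : ∀ P i j → coeff₂ P i j ≡ nth (row P i) j
coeff₂-row []       i       j = refl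
coeff₂-row (p ∷ ps) zero    j = refl
coeff₂-row (p ∷ ps) (suc i) j = coeff₂-row ps i j

nth-restrictY : ∀ P y i → nth (restrictY P y) i ≡ eval₁ (row P i) y
nth-restrictY []       y i       = refl
nth-restrictY (p ∷ ps) y zero    = refl
nth-restrictY (p ∷ ps) y (suc i) = nth-restrictY ps y i

≈₂-on-points : ∀ P Q r →
  (∀ μ k → eval₂ P (+ (μ ℕ.+ (r ℕ.+ 2 ℕ.* k))) (+ μ) ≡ eval₂ Q (+ (μ ℕ.+ (r ℕ.+ 2 ℕ.* k))) (+ μ)) →
  P ≈₂ Q
≈₂-on-points P Q r h i j = begin
  coeff₂ P i j      ≡⟨ coeff₂-row P i j ⟩
  nth (row P i) j   ≡⟨ ≈₁-on-progression (row P i) (row Q i) 0 1 (λ ()) rows j ⟩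
  nth (row Q i) j   ≡⟨ coeff₂-row Q i j ⟨
  coeff₂ Q i j      ∎
  where
  open ≡-Reasoning
  restrictions : ∀ μ → restrictY P (+ μ) ≈₁ restrictY Q (+ μ)
  restrictions μ = ≈₁-on-progression (restrictY P (+ μ)) (restrictY Q (+ μ)) (μ ℕ.+ r) 2 (λ ()) λ k →
    subst (λ m → eval₁ (restrictY P (+ μ)) (+ m) ≡ eval₁ (restrictY Q (+ μ)) (+ m)) (sym (ℕP.+-assoc μ r (2 ℕ.* k)))
      (trans (eval-restrictY P _ _) (trans (h μ k) (sym (eval-restrictY Q _ _))))
  rows : ∀ k → eval₁ (row P i) (+ (0 ℕ.+ 1 ℕ.* k)) ≡ eval₁ (row Q i) (+ (0 ℕ.+ 1 ℕ.* k))
  rows k = subst (λ m → eval₁ (row P i) (+ m) ≡ eval₁ (row Q i) (+ m)) (sym (ℕP.*-identityˡ k))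
    (trans (sym (nth-restrictY P (+ k) i)) (trans (restrictions k i) (nth-restrictY Q (+ k) i)))

-- Sparse polynomials multiply easily; toPoly₂ converts them to the dense Poly₂.

Mono : Set
Mono = ℤ × ℕ × ℕ

MPoly : Set
MPoly = List Mono

evalMono : Mono → ℤ → ℤ → ℤ
evalMono (c , i , j) x y = c * (x ^ i * y ^ j)

evalM : MPoly → ℤ → ℤ → ℤ
evalM []      x y = + 0
evalM (m ∷ M) x y = evalMono m x y + evalM M x y

δ : ℕ → ℕ → ℤ → ℤ
δ a b c = if a ℕ.≡ᵇ b then c else + 0

coeffMono : Mono → ℕ → ℕ → ℤ
coeffMono (c , i , j) i′ j′ = δ i i′ (δ j j′ c)

coeffM : MPoly → ℕ → ℕ → ℤ
coeffM []      i j = + 0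
coeffM (m ∷ M) i j = coeffMono m i j + coeffM M i j

negM : MPoly → MPoly
negM = L.map λ { (c , i , j) → - c , i , j }

infixl 6 _−ₘ_
_−ₘ_ : MPoly → MPoly → MPoly
M −ₘ N = M ++ negM N

mulMono : Mono → Mono → Mono
mulMono (c , i , j) (c′ , i′ , j′) = c * c′ , i ℕ.+ i′ , j ℕ.+ j′

mulM : MPoly → MPoly → MPoly
mulM []      N = []
mulM (m ∷ M) N = L.map (mulMono m) N ++ mulM M N

oneM : MPoly
oneM = (+ 1 , 0 , 0) ∷ []

evalM-++ : ∀ M N x y → evalM (M ++ N) x y ≡ evalM M x y + evalM N x y
evalM-++ []      N x y = sym (ℤP.+-identityˡ _)
evalM-++ (m ∷ M) N x y = trans (cong (λ e → evalMono m x y + e) (evalM-++ M N x y))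
  (sym (ℤP.+-assoc (evalMono m x y) (evalM M x y) (evalM N x y)))

evalM-neg : ∀ M x y → evalM (negM M) x y ≡ - evalM M x y
evalM-neg []              x y = refl
evalM-neg ((c , i , j) ∷ M) x y = trans (cong₂ _+_ (sym (ℤP.neg-distribˡ-* c _)) (evalM-neg M x y))
  (sym (ℤP.neg-distrib-+ (c * (x ^ i * y ^ j)) _))

evalM-− : ∀ M N x y → evalM (M −ₘ N) x y ≡ evalM M x y - evalM N x y
evalM-− M N x y = trans (evalM-++ M (negM N) x y) (cong (λ e → evalM M x y + e) (evalM-neg N x y))

evalM-mul : ∀ M N x y → evalM (mulM M N) x y ≡ evalM M x y * evalM N x y
evalM-mul []      N x y = refl
evalM-mul (m ∷ M) N x y = begin
  evalM (L.map (mulMono m) N ++ mulM M N) x y                ≡⟨ evalM-++ (L.map (mulMono m) N) _ x y ⟩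
  evalM (L.map (mulMono m) N) x y + evalM (mulM M N) x y     ≡⟨ cong₂ _+_ (evalM-map N) (evalM-mul M N x y) ⟩
  evalMono m x y * evalM N x y + evalM M x y * evalM N x y
    ≡⟨ ℤP.*-distribʳ-+ (evalM N x y) (evalMono m x y) _ ⟨
  (evalMono m x y + evalM M x y) * evalM N x y               ∎
  where
  open ≡-Reasoning
  evalMono-mul : ∀ m m′ → evalMono (mulMono m m′) x y ≡ evalMono m x y * evalMono m′ x y
  evalMono-mul (c , i , j) (c′ , i′ , j′) rewrite ℤP.^-distribˡ-+-* x i i′ | ℤP.^-distribˡ-+-* y j j′ =
    solve 6 (λ c c′ a a′ b b′ → c :* c′ :* (a :* a′ :* (b :* b′)) := c :* (a :* b) :* (c′ :* (a′ :* b′)))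
      refl c c′ (x ^ i) (x ^ i′) (y ^ j) (y ^ j′)
  evalM-map : ∀ N → evalM (L.map (mulMono m) N) x y ≡ evalMono m x y * evalM N x y
  evalM-map []       = sym (ℤP.*-zeroʳ (evalMono m x y))
  evalM-map (m′ ∷ N) = trans (cong₂ _+_ (evalMono-mul m m′) (evalM-map N))
    (sym (ℤP.*-distribˡ-+ (evalMono m x y) _ (evalM N x y)))

coeffM-++ : ∀ M N i j → coeffM (M ++ N) i j ≡ coeffM M i j + coeffM N i j
coeffM-++ []      N i j = sym (ℤP.+-identityˡ _)
coeffM-++ (m ∷ M) N i j = trans (cong (λ e → coeffMono m i j + e) (coeffM-++ M N i j))
  (sym (ℤP.+-assoc (coeffMono m i j) (coeffM M i j) (coeffM N i j)))

δ-neg : ∀ a b c → δ a b (- c) ≡ - δ a b c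
δ-neg a b c with a ℕ.≡ᵇ b
... | true  = refl
... | false = refl

δ-≢ : ∀ {a b} c → a ≢ b → δ a b c ≡ + 0
δ-≢ {a} {b} c a≢b with a ℕ.≡ᵇ b in eq
... | true  = contradiction (ℕP.≡ᵇ⇒≡ a b (subst T (sym eq) _)) a≢b
... | false = refl

coeffM-neg : ∀ M i j → coeffM (negM M) i j ≡ - coeffM M i j
coeffM-neg []                i′ j′ = refl
coeffM-neg ((c , i , j) ∷ M) i′ j′ =
  trans (cong₂ _+_ (trans (cong (δ i i′) (δ-neg j j′ c)) (δ-neg i i′ _)) (coeffM-neg M i′ j′))
        (sym (ℤP.neg-distrib-+ (coeffMono (c , i , j) i′ j′) (coeffM M i′ j′)))

coeffM-− : ∀ M N i j → coeffM (M −ₘ N) i j ≡ coeffM M i j - coeffM N i j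
coeffM-− M N i j = trans (coeffM-++ M (negM N) i j) (cong (λ e → coeffM M i j + e) (coeffM-neg N i j))

degree : Mono → ℕ
degree (c , i , j) = i ℕ.+ j

DegreeAtMost : ℕ → MPoly → Set
DegreeAtMost k = All λ m → degree m ℕ.≤ k

DegreeAtMost-− : ∀ {k M N} → DegreeAtMost k M → DegreeAtMost k N → DegreeAtMost k (M −ₘ N)
DegreeAtMost-− hM hN = AllP.++⁺ hM (AllP.map⁺ hN)

DegreeAtMost-mono : ∀ {k k′ M} → k ℕ.≤ k′ → DegreeAtMost k M → DegreeAtMost k′ M
DegreeAtMost-mono k≤k′ = All.map (λ le → ℕP.≤-trans le k≤k′)

DegreeAtMost-mul : ∀ {k k′ M N} → DegreeAtMost k M → DegreeAtMost k′ N → DegreeAtMost (k ℕ.+ k′) (mulM M N)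
DegreeAtMost-mul []                   hN = []
DegreeAtMost-mul {k} {k′} (_∷_ {m} m≤k hM) hN =
  AllP.++⁺ (AllP.map⁺ (All.map (λ {m′} m′≤k′ → subst (ℕ._≤ k ℕ.+ k′) (sym (degree-mul m m′)) (ℕP.+-mono-≤ m≤k m′≤k′)) hN))
           (DegreeAtMost-mul hM hN)
  where
  degree-mul : ∀ m m′ → degree (mulMono m m′) ≡ degree m ℕ.+ degree m′
  degree-mul (c , i , j) (c′ , i′ , j′) = interchange ℕP.+-commutativeSemigroup i i′ j j′

coeffM-beyond-degree : ∀ {k M} → DegreeAtMost k M → ∀ i j → k ℕ.< i ℕ.+ j → coeffM M i j ≡ + 0
coeffM-beyond-degree []                                  i j k<i+j = refl
coeffM-beyond-degree (_∷_ {c , i′ , j′} i′+j′≤k hM) i j k<i+j =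
  trans (cong₂ _+_ vanish (coeffM-beyond-degree hM i j k<i+j)) (ℤP.+-identityˡ (+ 0))
  where
  vanish : δ i′ i (δ j′ j c) ≡ + 0
  vanish with i′ ℕ.≟ i | j′ ℕ.≟ j
  ... | yes refl | yes refl = contradiction i′+j′≤k (ℕP.<⇒≱ k<i+j)
  ... | no i′≢i  | _        = δ-≢ _ i′≢i
  ... | yes refl | no j′≢j  = trans (cong (δ i′ i′) (δ-≢ c j′≢j)) (δ-0 i′ i′)
    where
    δ-0 : ∀ a b → δ a b (+ 0) ≡ + 0
    δ-0 a b with a ℕ.≡ᵇ b
    ... | true  = refl
    ... | false = refl

addAt : ℤ → ℕ → Poly₁ → Poly₁
addAt c zero    []       = c ∷ []
addAt c zero    (a ∷ as) = c + a ∷ as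
addAt c (suc j) []       = + 0 ∷ addAt c j []
addAt c (suc j) (a ∷ as) = a ∷ addAt c j as

nth-addAt : ∀ c j p j′ → nth (addAt c j p) j′ ≡ δ j j′ c + nth p j′
nth-addAt c zero    []       zero     = sym (ℤP.+-identityʳ c)
nth-addAt c zero    []       (suc j′) = refl
nth-addAt c zero    (a ∷ as) zero     = refl
nth-addAt c zero    (a ∷ as) (suc j′) = sym (ℤP.+-identityˡ _)
nth-addAt c (suc j) []       zero     = refl
nth-addAt c (suc j) []       (suc j′) = nth-addAt c j [] j′
nth-addAt c (suc j) (a ∷ as) zero     = sym (ℤP.+-identityˡ a)
nth-addAt c (suc j) (a ∷ as) (suc j′) = nth-addAt c j as j′

eval-addAt : ∀ c j p y → eval₁ (addAt c j p) y ≡ c * y ^ j + eval₁ p y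
eval-addAt c zero    []       y = solve 2 (λ c y → c :+ y :* con (+ 0) := c :* con (+ 1) :+ con (+ 0)) refl c y
eval-addAt c zero    (a ∷ as) y =
  solve 4 (λ c a y e → c :+ a :+ y :* e := c :* con (+ 1) :+ (a :+ y :* e)) refl c a y (eval₁ as y)
eval-addAt c (suc j) []       y = trans (cong (λ e → + 0 + y * e) (eval-addAt c j [] y))
  (solve 3 (λ c y p → con (+ 0) :+ y :* (c :* p :+ con (+ 0)) := c :* (y :* p) :+ con (+ 0)) refl c y (y ^ j))
eval-addAt c (suc j) (a ∷ as) y = trans (cong (λ e → a + y * e) (eval-addAt c j as y))
  (solve 5 (λ c a y p e → a :+ y :* (c :* p :+ e) := c :* (y :* p) :+ (a :+ y :* e)) refl c a y (y ^ j) (eval₁ as y))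

addMono : Mono → Poly₂ → Poly₂
addMono (c , zero  , j) []      = addAt c j [] ∷ []
addMono (c , zero  , j) (p ∷ P) = addAt c j p ∷ P
addMono (c , suc i , j) []      = [] ∷ addMono (c , i , j) []
addMono (c , suc i , j) (p ∷ P) = p ∷ addMono (c , i , j) P

coeff₂-addMono : ∀ m P i j → coeff₂ (addMono m P) i j ≡ coeffMono m i j + coeff₂ P i j
coeff₂-addMono (c , zero  , j′) []      zero    j = nth-addAt c j′ [] j
coeff₂-addMono (c , zero  , j′) []      (suc i) j = refl
coeff₂-addMono (c , zero  , j′) (p ∷ P) zero    j = nth-addAt c j′ p j
coeff₂-addMono (c , zero  , j′) (p ∷ P) (suc i) j = sym (ℤP.+-identityˡ _)
coeff₂-addMono (c , suc i′ , j′) []      zero    j = refl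
coeff₂-addMono (c , suc i′ , j′) []      (suc i) j = coeff₂-addMono (c , i′ , j′) [] i j
coeff₂-addMono (c , suc i′ , j′) (p ∷ P) zero    j = sym (ℤP.+-identityˡ _)
coeff₂-addMono (c , suc i′ , j′) (p ∷ P) (suc i) j = coeff₂-addMono (c , i′ , j′) P i j

eval₂-addMono : ∀ m P x y → eval₂ (addMono m P) x y ≡ evalMono m x y + eval₂ P x y
eval₂-addMono (c , zero , j) [] x y = trans (cong (λ e → e + x * + 0) (eval-addAt c j [] y))
  (solve 3 (λ c x q → c :* q :+ con (+ 0) :+ x :* con (+ 0) := c :* (con (+ 1) :* q) :+ con (+ 0)) refl c x (y ^ j))
eval₂-addMono (c , zero , j) (p ∷ P) x y = trans (cong (λ e → e + x * eval₂ P x y) (eval-addAt c j p y))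
  (solve 5 (λ c x q e f → c :* q :+ e :+ x :* f := c :* (con (+ 1) :* q) :+ (e :+ x :* f))
         refl c x (y ^ j) (eval₁ p y) (eval₂ P x y))
eval₂-addMono (c , suc i , j) [] x y = trans (cong (λ e → + 0 + x * e) (eval₂-addMono (c , i , j) [] x y))
  (solve 4 (λ c x p q → con (+ 0) :+ x :* (c :* (p :* q) :+ con (+ 0)) := c :* (x :* p :* q) :+ con (+ 0))
         refl c x (x ^ i) (y ^ j))
eval₂-addMono (c , suc i , j) (p ∷ P) x y = trans (cong (λ e → eval₁ p y + x * e) (eval₂-addMono (c , i , j) P x y))
  (solve 6 (λ c x a b e f → e :+ x :* (c :* (a :* b) :+ f) := c :* (x :* a :* b) :+ (e :+ x :* f))
         refl c x (x ^ i) (y ^ j) (eval₁ p y) (eval₂ P x y))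

toPoly₂ : MPoly → Poly₂
toPoly₂ = L.foldr addMono []

coeff₂-toPoly₂ : ∀ M i j → coeff₂ (toPoly₂ M) i j ≡ coeffM M i j
coeff₂-toPoly₂ []      i j = refl
coeff₂-toPoly₂ (m ∷ M) i j =
  trans (coeff₂-addMono m (toPoly₂ M) i j) (cong (λ e → coeffMono m i j + e) (coeff₂-toPoly₂ M i j))

eval₂-toPoly₂ : ∀ M x y → eval₂ (toPoly₂ M) x y ≡ evalM M x y
eval₂-toPoly₂ []      x y = refl
eval₂-toPoly₂ (m ∷ M) x y =
  trans (eval₂-addMono m (toPoly₂ M) x y) (cong (λ e → evalMono m x y + e) (eval₂-toPoly₂ M x y))

coeffM-from-evalM : ∀ M N → (∀ x y → evalM M (+ x) (+ y) ≡ evalM N (+ x) (+ y)) → ∀ i j → coeffM M i j ≡ coeffM N i j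
coeffM-from-evalM M N h i j = begin
  coeffM M i j            ≡⟨ coeff₂-toPoly₂ M i j ⟨
  coeff₂ (toPoly₂ M) i j  ≡⟨ ≈₂-on-points (toPoly₂ M) (toPoly₂ N) 0 values i j ⟩
  coeff₂ (toPoly₂ N) i j  ≡⟨ coeff₂-toPoly₂ N i j ⟩
  coeffM N i j            ∎
  where
  open ≡-Reasoning
  values : ∀ μ k → eval₂ (toPoly₂ M) _ (+ μ) ≡ eval₂ (toPoly₂ N) _ (+ μ)
  values μ k = trans (eval₂-toPoly₂ M _ _) (trans (h _ μ) (sym (eval₂-toPoly₂ N _ _)))

∑ : {A : Set} → List A → (A → ℤ) → ℤ
∑ as f = L.foldr _+_ (+ 0) (L.map f as)

infix 5 ∑
syntax ∑ as (λ a → e) = ∑[ a ∈ as ] e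

module _ {A : Set} where

  ∑-cong : ∀ (as : List A) {f g} → (∀ a → f a ≡ g a) → ∑ as f ≡ ∑ as g
  ∑-cong []       f≗g = refl
  ∑-cong (a ∷ as) f≗g = cong₂ _+_ (f≗g a) (∑-cong as f≗g)

  ∑-cong-∈ : ∀ (as : List A) {f g} → (∀ a → a ∈ as → f a ≡ g a) → ∑ as f ≡ ∑ as g
  ∑-cong-∈ []       f≗g = refl
  ∑-cong-∈ (a ∷ as) f≗g = cong₂ _+_ (f≗g a (here refl)) (∑-cong-∈ as λ b b∈as → f≗g b (there b∈as))

  ∑-0 : ∀ (as : List A) → ∑[ a ∈ as ] + 0 ≡ + 0
  ∑-0 []       = refl
  ∑-0 (a ∷ as) = trans (ℤP.+-identityˡ _) (∑-0 as)

  ∑-+ : ∀ (as : List A) f g → ∑[ a ∈ as ] (f a + g a) ≡ ∑ as f + ∑ as g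
  ∑-+ []       f g = refl
  ∑-+ (a ∷ as) f g = trans (cong (λ e → f a + g a + e) (∑-+ as f g))
    (solve 4 (λ p q r s → p :+ q :+ (r :+ s) := p :+ r :+ (q :+ s)) refl (f a) (g a) (∑ as f) (∑ as g))

  ∑-− : ∀ (as : List A) f g → ∑[ a ∈ as ] (f a - g a) ≡ ∑ as f - ∑ as g
  ∑-− []       f g = refl
  ∑-− (a ∷ as) f g = trans (cong (λ e → f a - g a + e) (∑-− as f g))
    (solve 4 (λ p q r s → p :- q :+ (r :- s) := p :+ r :- (q :+ s)) refl (f a) (g a) (∑ as f) (∑ as g))

  ∑-*ˡ : ∀ (as : List A) k f → ∑[ a ∈ as ] k * f a ≡ k * ∑ as f
  ∑-*ˡ []       k f = sym (ℤP.*-zeroʳ k)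
  ∑-*ˡ (a ∷ as) k f = trans (cong (λ e → k * f a + e) (∑-*ˡ as k f)) (sym (ℤP.*-distribˡ-+ k (f a) (∑ as f)))

  ∑-*ʳ : ∀ (as : List A) f k → ∑[ a ∈ as ] (f a * k) ≡ ∑ as f * k
  ∑-*ʳ []       f k = sym (ℤP.*-zeroˡ k)
  ∑-*ʳ (a ∷ as) f k = trans (cong (λ e → f a * k + e) (∑-*ʳ as f k)) (sym (ℤP.*-distribʳ-+ k (f a) (∑ as f)))

  ∑-++ : ∀ (as bs : List A) f → ∑ (as ++ bs) f ≡ ∑ as f + ∑ bs f
  ∑-++ []       bs f = sym (ℤP.+-identityˡ _)
  ∑-++ (a ∷ as) bs f = trans (cong (λ e → f a + e) (∑-++ as bs f)) (sym (ℤP.+-assoc (f a) (∑ as f) (∑ bs f)))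

  ∑-const-∈ : ∀ (as : List A) f k → (∀ a → a ∈ as → f a ≡ k) → ∑ as f ≡ + length as * k
  ∑-const-∈ []       f k f≡k = sym (ℤP.*-zeroˡ k)
  ∑-const-∈ (a ∷ as) f k f≡k =
    trans (cong₂ _+_ (f≡k a (here refl)) (∑-const-∈ as f k λ b b∈as → f≡k b (there b∈as)))
    (solve 2 (λ k l → k :+ l :* k := (con (+ 1) :+ l) :* k) refl k (+ length as))

∑-comm : {A B : Set} (as : List A) (bs : List B) (h : A → B → ℤ) →
  ∑[ a ∈ as ] ∑[ b ∈ bs ] h a b ≡ ∑[ b ∈ bs ] ∑[ a ∈ as ] h a b
∑-comm []       bs h = sym (∑-0 bs)
∑-comm (a ∷ as) bs h = trans (cong (λ e → ∑ bs (h a) + e) (∑-comm as bs h))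
  (sym (∑-+ bs (h a) λ b → ∑[ a′ ∈ as ] h a′ b))

∑-↭ : {A : Set} {as bs : List A} (f : A → ℤ) → as ↭ bs → ∑ as f ≡ ∑ bs f
∑-↭ f as↭bs = foldr-commMonoid ℤP.+-0-isCommutativeMonoid (↭⇒↭ₛ (↭P.map⁺ f as↭bs))

𝟙 : Bool → ℤ
𝟙 true  = + 1
𝟙 false = + 0

𝟙-∧ : ∀ a b → 𝟙 (a ∧ b) ≡ 𝟙 a * 𝟙 b
𝟙-∧ true  b = sym (ℤP.*-identityˡ (𝟙 b))
𝟙-∧ false b = refl

𝟙-not : ∀ b → 𝟙 (not b) ≡ + 1 - 𝟙 b
𝟙-not true  = refl
𝟙-not false = refl

infix 5 _∈ᵇ_
_∈ᵇ_ : ℤ → List ℤ → Bool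
c ∈ᵇ C = does (c ∈? C)

∑-pick : ∀ {C} → Unique C → ∀ t (h : ℤ → ℤ) → ∑[ c ∈ C ] (𝟙 (does (c ℤ.≟ t)) * h c) ≡ 𝟙 (t ∈ᵇ C) * h t
∑-pick {[]}    []            t h = refl
∑-pick {c ∷ C} (c∉C ∷ uC) t h with c ℤ.≟ t
... | yes refl rewrite dec-true (c ℤ.≟ c) refl = begin
  + 1 * h c + (∑[ c′ ∈ C ] 𝟙 (does (c′ ℤ.≟ c)) * h c′) ≡⟨ cong (λ e → + 1 * h c + e) (∑-pick uC c h) ⟩
  + 1 * h c + 𝟙 (c ∈ᵇ C) * h c                     ≡⟨ cong (λ b → + 1 * h c + 𝟙 b * h c) c∉ᵇC ⟩
  + 1 * h c + + 0 * h c
    ≡⟨ solve 1 (λ a → con (+ 1) :* a :+ con (+ 0) :* a := con (+ 1) :* a) refl (h c) ⟩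
  + 1 * h c                                        ∎
  where
  open ≡-Reasoning
  c∉ᵇC : c ∈ᵇ C ≡ false
  c∉ᵇC = dec-false (c ∈? C) (AllP.All¬⇒¬Any c∉C)
... | no c≢t rewrite dec-false (t ℤ.≟ c) (λ t≡c → c≢t (sym t≡c)) =
  trans (cong (λ e → + 0 * h c + e) (∑-pick uC t h)) (ℤP.+-identityˡ _)

∑ᵛ : List ℤ → (n : ℕ) → (Vec ℤ n → ℤ) → ℤ
∑ᵛ C zero    g = g []ᵥ
∑ᵛ C (suc n) g = ∑[ c ∈ C ] ∑ᵛ C n (λ w → g (c ∷ᵥ w))

module _ (C : List ℤ) where

  ∑ᵛ-cong : ∀ n {g h} → (∀ κ → g κ ≡ h κ) → ∑ᵛ C n g ≡ ∑ᵛ C n h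
  ∑ᵛ-cong zero    g≗h = g≗h []ᵥ
  ∑ᵛ-cong (suc n) g≗h = ∑-cong C λ c → ∑ᵛ-cong n λ w → g≗h (c ∷ᵥ w)

  ∑ᵛ-cong-∈ : ∀ n {g h} → (∀ κ → (∀ v → lookup κ v ∈ C) → g κ ≡ h κ) → ∑ᵛ C n g ≡ ∑ᵛ C n h
  ∑ᵛ-cong-∈ zero    g≗h = g≗h []ᵥ λ ()
  ∑ᵛ-cong-∈ (suc n) g≗h = ∑-cong-∈ C λ c c∈C → ∑ᵛ-cong-∈ n λ w w∈C →
    g≗h (c ∷ᵥ w) λ { F.zero → c∈C ; (F.suc v) → w∈C v }

  ∑ᵛ-− : ∀ n g h → ∑ᵛ C n (λ κ → g κ - h κ) ≡ ∑ᵛ C n g - ∑ᵛ C n h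
  ∑ᵛ-− zero    g h = refl
  ∑ᵛ-− (suc n) g h = trans (∑-cong C λ c → ∑ᵛ-− n _ _) (∑-− C _ _)

  ∑ᵛ-*ˡ : ∀ n k g → ∑ᵛ C n (λ κ → k * g κ) ≡ k * ∑ᵛ C n g
  ∑ᵛ-*ˡ zero    k g = refl
  ∑ᵛ-*ˡ (suc n) k g = trans (∑-cong C λ c → ∑ᵛ-*ˡ n k _) (∑-*ˡ C k _)

  ∑ᵛ-∑ : {A : Set} (as : List A) (n : ℕ) (h : A → Vec ℤ n → ℤ) →
    ∑ᵛ C n (λ κ → ∑[ a ∈ as ] h a κ) ≡ ∑[ a ∈ as ] ∑ᵛ C n (h a)
  ∑ᵛ-∑ as zero    h = refl
  ∑ᵛ-∑ as (suc n) h = trans (∑-cong C λ c → ∑ᵛ-∑ as n λ a w → h a (c ∷ᵥ w))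
    (∑-comm C as λ c a → ∑ᵛ C n λ w → h a (c ∷ᵥ w))

  ∑ᵛ-insertAt : ∀ n (i : Fin (suc n)) g → ∑ᵛ C (suc n) g ≡ ∑[ c ∈ C ] ∑ᵛ C n (λ w → g (insertAt w i c))
  ∑ᵛ-insertAt n       F.zero    g = refl
  ∑ᵛ-insertAt (suc n) (F.suc i) g =
    trans (∑-cong C λ c′ → ∑ᵛ-insertAt n i λ w → g (c′ ∷ᵥ w))
          (∑-comm C C λ c′ c → ∑ᵛ C n λ w → g (c′ ∷ᵥ insertAt w i c))

count-++ : ∀ {A : Set} (p : A → Bool) xs ys → count p (xs ++ ys) ≡ count p xs ℕ.+ count p ys
count-++ p []       ys = refl
count-++ p (x ∷ xs) ys with p x
... | true  = cong suc (count-++ p xs ys)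
... | false = count-++ p xs ys

count-map : ∀ {A B : Set} (p : B → Bool) (f : A → B) xs → count p (L.map f xs) ≡ count (λ a → p (f a)) xs
count-map p f []       = refl
count-map p f (x ∷ xs) with p (f x)
... | true  = cong suc (count-map p f xs)
... | false = count-map p f xs

count-cong : ∀ {A : Set} {p q : A → Bool} → (∀ x → p x ≡ q x) → ∀ xs → count p xs ≡ count q xs
count-cong p≗q []       = refl
count-cong {p = p} {q} p≗q (x ∷ xs) rewrite p≗q x with q x
... | true  = cong suc (count-cong p≗q xs)
... | false = count-cong p≗q xs

+count-allMaps : ∀ C n (p : Vec ℤ n → Bool) → + count p (allMaps C n) ≡ ∑ᵛ C n (λ κ → 𝟙 (p κ))
+count-allMaps C zero    p with p []ᵥ
... | true  = refl
... | false = refl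
+count-allMaps C (suc n) p = go C
  where
  go : ∀ D → + count p (concatMap (λ c → L.map (c ∷ᵥ_) (allMaps C n)) D) ≡ ∑[ c ∈ D ] ∑ᵛ C n (λ w → 𝟙 (p (c ∷ᵥ w)))
  go []      = refl
  go (c ∷ D) = begin
    + count p (L.map (c ∷ᵥ_) (allMaps C n) ++ rest)
      ≡⟨ cong +_ (count-++ p (L.map (c ∷ᵥ_) (allMaps C n)) rest) ⟩
    + (count p (L.map (c ∷ᵥ_) (allMaps C n)) ℕ.+ count p rest)   ≡⟨ ℤP.pos-+ _ (count p rest) ⟩
    + count p (L.map (c ∷ᵥ_) (allMaps C n)) + + count p rest     ≡⟨ cong₂ _+_ (trans (cong +_ (count-map p (c ∷ᵥ_) (allMaps C n)))
                                                                      (+count-allMaps C n λ w → p (c ∷ᵥ w))) (go D) ⟩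
    ∑ᵛ C n (λ w → 𝟙 (p (c ∷ᵥ w))) + (∑[ c′ ∈ D ] ∑ᵛ C n (λ w → 𝟙 (p (c′ ∷ᵥ w))))  ∎
    where
    open ≡-Reasoning
    rest = concatMap (λ c → L.map (c ∷ᵥ_) (allMaps C n)) D

∏ : ∀ {n} → Vector ℤ n → ℤ
∏ = foldr _*_ (+ 1)

∏-cong : ∀ {n} {f g : Vector ℤ n} → (∀ v → f v ≡ g v) → ∏ f ≡ ∏ g
∏-cong {zero}  f≗g = refl
∏-cong {suc n} f≗g = cong₂ _*_ (f≗g F.zero) (∏-cong (λ v → f≗g (F.suc v)))

∏-const : ∀ {n} (f : Vector ℤ n) x → (∀ v → f v ≡ x) → ∏ f ≡ x ^ n
∏-const {zero}  f x f≡x = refl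
∏-const {suc n} f x f≡x = cong₂ _*_ (f≡x F.zero) (∏-const (tail f) x (λ v → f≡x (F.suc v)))

∏-const-but-one : ∀ {n} (f : Vector ℤ (suc n)) x j → (∀ v → v ≢ j → f v ≡ x) → ∏ f ≡ f j * x ^ n
∏-const-but-one         f x F.zero    f≡x = cong (f F.zero *_) (∏-const (tail f) x λ v → f≡x (F.suc v) λ ())
∏-const-but-one {suc n} f x (F.suc j) f≡x = begin
  f F.zero * ∏ (tail f)
    ≡⟨ cong₂ _*_ (f≡x F.zero λ ()) (∏-const-but-one (tail f) x j λ v v≢j → f≡x (F.suc v) (v≢j ∘ FP.suc-injective)) ⟩
  x * (f (F.suc j) * x ^ n)
    ≡⟨ solve 3 (λ x a p → x :* (a :* p) := a :* (x :* p)) refl x (f (F.suc j)) (x ^ n) ⟩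
  f (F.suc j) * (x * x ^ n)      ∎
  where open ≡-Reasoning

-- Constraint systems and deletion–contraction

Constraint : ℕ → Set
Constraint n = Fin n × Fin n × Bool

satisfies : ∀ {n} → Vec ℤ n → Constraint n → Bool
satisfies κ (i , j , s) = not (does (lookup κ i ℤ.≟ sgn s * lookup κ j))

satisfiesAll : ∀ {n m} → Vec (Constraint n) m → Vec ℤ n → ℤ
satisfiesAll []ᵥ       κ = + 1
satisfiesAll (e ∷ᵥ es) κ = 𝟙 (satisfies κ e) * satisfiesAll es κ

-- A v is the set of colours allowed at the vertex v.
weight : ∀ {n} → Vector (ℤ → Bool) n → Vec ℤ n → ℤ
weight A []ᵥ      = + 1
weight A (c ∷ᵥ κ) = 𝟙 (head A c) * weight (tail A) κ

#proper : List ℤ → ∀ {n m} → Vector (ℤ → Bool) n → Vec (Constraint n) m → ℤ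
#proper C {n} A cs = ∑ᵛ C n λ κ → weight A κ * satisfiesAll cs κ

isZero : ℤ → Bool
isZero c = does (c ℤ.≟ + 0)

withoutZero : (ℤ → Bool) → ℤ → Bool
withoutZero P c = P c ∧ not (isZero c)

infixl 7 _·ₛ_
_·ₛ_ : Bool → Bool → Bool
true  ·ₛ b = b
false ·ₛ b = not b

sgn-·ₛ : ∀ a b → sgn (a ·ₛ b) ≡ sgn a * sgn b
sgn-·ₛ true  true  = refl
sgn-·ₛ true  false = refl
sgn-·ₛ false true  = refl
sgn-·ₛ false false = refl

sgn-involutive : ∀ a x → sgn a * (sgn a * x) ≡ x
sgn-involutive true  x = trans (ℤP.*-identityˡ _) (ℤP.*-identityˡ x)
sgn-involutive false x = trans (ℤP.-1*i≡-i _) (trans (cong -_ (ℤP.-1*i≡-i x)) (ℤP.neg-involutive x))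

sgn-move : ∀ a x z → (sgn a * x ≡ z) ⇔ (x ≡ sgn a * z)
sgn-move a x z = mk⇔ (λ e → trans (sym (sgn-involutive a x)) (cong (sgn a *_) e))
                     (λ e → trans (cong (sgn a *_) e) (sgn-involutive a z))

-- Merging vertex i into j′ along κ i = sgn s * κ j′ relabels each vertex and records a sign.
relabel : ∀ {n} → Fin (suc n) → Fin n → Bool → Fin (suc n) → Fin n × Bool
relabel i j′ s v with i F.≟ v
... | yes _   = j′ , s
... | no i≢v = punchOut i≢v , true

contractConstraint : ∀ {n} → Fin (suc n) → Fin n → Bool → Constraint (suc n) → Constraint n
contractConstraint i j′ s (a , b , t) =
  proj₁ (relabel i j′ s a) , proj₁ (relabel i j′ s b) , proj₂ (relabel i j′ s a) ·ₛ (t ·ₛ proj₂ (relabel i j′ s b))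

-- the colours allowed at j once κ i = sgn s * κ j, if P is allowed at j and Q at i
mergeAllowed : List ℤ → Bool → (ℤ → Bool) → (ℤ → Bool) → ℤ → Bool
mergeAllowed C s Q P c = P c ∧ ((sgn s * c ∈ᵇ C) ∧ Q (sgn s * c))

contractAllowed : List ℤ → ∀ {n} → Fin (suc n) → Fin n → Bool → Vector (ℤ → Bool) (suc n) → Vector (ℤ → Bool) n
contractAllowed C i j′ s A = updateAt (removeAt A i) j′ (mergeAllowed C s (A i))

module _ {n} (i : Fin (suc n)) (j′ : Fin n) (s : Bool) (w : Vec ℤ n) where

  private
    merged : Vec ℤ (suc n)
    merged = insertAt w i (sgn s * lookup w j′)

  lookup-merged : ∀ v → lookup merged v ≡ sgn (proj₂ (relabel i j′ s v)) * lookup w (proj₁ (relabel i j′ s v))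
  lookup-merged v with i F.≟ v
  ... | yes refl = VP.insertAt-lookup w i _
  ... | no i≢v  = begin
    lookup merged v                                   ≡⟨ cong (lookup merged) (FP.punchIn-punchOut i≢v) ⟨
    lookup merged (punchIn i (punchOut i≢v))          ≡⟨ VP.insertAt-punchIn w i _ (punchOut i≢v) ⟩
    lookup w (punchOut i≢v)                           ≡⟨ ℤP.*-identityˡ _ ⟨
    sgn true * lookup w (punchOut i≢v)                ∎
    where open ≡-Reasoning

  satisfies-merged : ∀ e → satisfies merged e ≡ satisfies w (contractConstraint i j′ s e)
  satisfies-merged (a , b , t) with relabel i j′ s a in ra | relabel i j′ s b in rb
  ... | a′ , sa | b′ , sb =
    cong not (does-⇔ equivalent (lookup merged a ℤ.≟ sgn t * lookup merged b) (x ℤ.≟ sgn (sa ·ₛ (t ·ₛ sb)) * y))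
    where
    x = lookup w a′
    y = lookup w b′
    sign : sgn sa * (sgn t * (sgn sb * y)) ≡ sgn (sa ·ₛ (t ·ₛ sb)) * y
    sign = begin
      sgn sa * (sgn t * (sgn sb * y))
        ≡⟨ solve 4 (λ p q r y → p :* (q :* (r :* y)) := p :* (q :* r) :* y) refl (sgn sa) (sgn t) (sgn sb) y ⟩
      sgn sa * (sgn t * sgn sb) * y     ≡⟨ cong (λ u → sgn sa * u * y) (sgn-·ₛ t sb) ⟨
      sgn sa * sgn (t ·ₛ sb) * y        ≡⟨ cong (_* y) (sgn-·ₛ sa (t ·ₛ sb)) ⟨
      sgn (sa ·ₛ (t ·ₛ sb)) * y         ∎
      where open ≡-Reasoning
    equivalent : (lookup merged a ≡ sgn t * lookup merged b) ⇔ (x ≡ sgn (sa ·ₛ (t ·ₛ sb)) * y)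
    equivalent rewrite lookup-merged a | lookup-merged b | ra | rb | sym sign = sgn-move sa x _

  satisfiesAll-merged : ∀ {m} (cs : Vec (Constraint (suc n)) m) →
    satisfiesAll cs merged ≡ satisfiesAll (V.map (contractConstraint i j′ s) cs) w
  satisfiesAll-merged []ᵥ       = refl
  satisfiesAll-merged (e ∷ᵥ cs) = cong₂ (λ b r → 𝟙 b * r) (satisfies-merged e) (satisfiesAll-merged cs)

weight-insertAt : ∀ {n} (A : Vector (ℤ → Bool) (suc n)) w i c →
  weight A (insertAt w i c) ≡ 𝟙 (A i c) * weight (removeAt A i) w
weight-insertAt A w          F.zero    c = refl
weight-insertAt A (w₀ ∷ᵥ w) (F.suc i) c = begin
  𝟙 (A F.zero w₀) * weight (tail A) (insertAt w i c)
    ≡⟨ cong (𝟙 (A F.zero w₀) *_) (weight-insertAt (tail A) w i c) ⟩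
  𝟙 (A F.zero w₀) * (𝟙 (A (F.suc i) c) * weight (removeAt (tail A) i) w)
    ≡⟨ solve 3 (λ a b r → a :* (b :* r) := b :* (a :* r)) refl (𝟙 (A F.zero w₀)) (𝟙 (A (F.suc i) c)) (weight (removeAt (tail A) i) w) ⟩
  𝟙 (A (F.suc i) c) * (𝟙 (A F.zero w₀) * weight (removeAt (tail A) i) w) ∎
  where open ≡-Reasoning

weight-updateAt : ∀ {n} (A : Vector (ℤ → Bool) n) j (t : ℤ → Bool) κ →
  weight (updateAt A j λ P c → P c ∧ t c) κ ≡ weight A κ * 𝟙 (t (lookup κ j))
weight-updateAt A F.zero    t (c ∷ᵥ κ) = begin
  𝟙 (A F.zero c ∧ t c) * weight (tail A) κ            ≡⟨ cong (_* weight (tail A) κ) (𝟙-∧ (A F.zero c) (t c)) ⟩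
  𝟙 (A F.zero c) * 𝟙 (t c) * weight (tail A) κ
    ≡⟨ solve 3 (λ a b r → a :* b :* r := a :* r :* b) refl (𝟙 (A F.zero c)) (𝟙 (t c)) (weight (tail A) κ) ⟩
  𝟙 (A F.zero c) * weight (tail A) κ * 𝟙 (t c)        ∎
  where open ≡-Reasoning
weight-updateAt A (F.suc j) t (c ∷ᵥ κ) =
  trans (cong (𝟙 (A F.zero c) *_) (weight-updateAt (tail A) j t κ))
    (sym (ℤP.*-assoc (𝟙 (A F.zero c)) (weight (tail A) κ) (𝟙 (t (lookup κ j)))))

weight-∑ᵛ : ∀ C {n} (A : Vector (ℤ → Bool) n) → ∑ᵛ C n (weight A) ≡ ∏ λ v → ∑[ c ∈ C ] 𝟙 (A v c)
weight-∑ᵛ C {zero}  A = refl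
weight-∑ᵛ C {suc n} A = begin
  ∑[ c ∈ C ] ∑ᵛ C n (λ w → 𝟙 (A F.zero c) * weight (tail A) w)
    ≡⟨ ∑-cong C (λ c → ∑ᵛ-*ˡ C n (𝟙 (A F.zero c)) (weight (tail A))) ⟩
  ∑[ c ∈ C ] 𝟙 (A F.zero c) * ∑ᵛ C n (weight (tail A))
    ≡⟨ ∑-*ʳ C (λ c → 𝟙 (A F.zero c)) (∑ᵛ C n (weight (tail A))) ⟩
  (∑[ c ∈ C ] 𝟙 (A F.zero c)) * ∑ᵛ C n (weight (tail A))
    ≡⟨ cong (λ e → (∑[ c ∈ C ] 𝟙 (A F.zero c)) * e) (weight-∑ᵛ C (tail A)) ⟩
  (∑[ c ∈ C ] 𝟙 (A F.zero c)) * ∏ (λ v → ∑[ c ∈ C ] 𝟙 (tail A v c)) ∎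
  where open ≡-Reasoning

weight-cong : ∀ {n} {A B : Vector (ℤ → Bool) n} → (∀ v c → A v c ≡ B v c) → ∀ κ → weight A κ ≡ weight B κ
weight-cong A≗B []ᵥ      = refl
weight-cong A≗B (c ∷ᵥ κ) = cong₂ (λ b r → 𝟙 b * r) (A≗B F.zero c) (weight-cong (λ v → A≗B (F.suc v)) κ)

module _ (C : List ℤ) where

  #proper-cong : ∀ {n m} {A B : Vector (ℤ → Bool) n} → (∀ v c → A v c ≡ B v c) →
    (cs : Vec (Constraint n) m) → #proper C A cs ≡ #proper C B cs
  #proper-cong {n} A≗B cs = ∑ᵛ-cong C n λ κ → cong (_* satisfiesAll cs κ) (weight-cong A≗B κ)

  #proper-[] : ∀ {n} (A : Vector (ℤ → Bool) n) → #proper C A []ᵥ ≡ ∏ λ v → ∑[ c ∈ C ] 𝟙 (A v c)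
  #proper-[] {n} A = trans (∑ᵛ-cong C n λ κ → ℤP.*-identityʳ (weight A κ)) (weight-∑ᵛ C A)

  #proper-loop⁺ : ∀ {n m} (A : Vector (ℤ → Bool) n) i (cs : Vec (Constraint n) m) →
    #proper C A ((i , i , true) ∷ᵥ cs) ≡ + 0
  #proper-loop⁺ {n} A i cs = begin
    ∑ᵛ C n (λ κ → weight A κ * (𝟙 (satisfies κ (i , i , true)) * satisfiesAll cs κ)) ≡⟨ ∑ᵛ-cong C n vanish ⟩
    ∑ᵛ C n (λ κ → + 0 * weight A κ)
      ≡⟨ ∑ᵛ-*ˡ C n (+ 0) (weight A) ⟩
    + 0                                                                              ∎
    where
    open ≡-Reasoning
    vanish : ∀ κ → weight A κ * (𝟙 (satisfies κ (i , i , true)) * satisfiesAll cs κ) ≡ + 0 * weight A κ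
    vanish κ rewrite dec-true (lookup κ i ℤ.≟ sgn true * lookup κ i) (sym (ℤP.*-identityˡ _)) =
      solve 2 (λ w r → w :* (con (+ 0) :* r) := con (+ 0) :* w) refl (weight A κ) (satisfiesAll cs κ)

  #proper-loop⁻ : ∀ {n m} (A : Vector (ℤ → Bool) n) i (cs : Vec (Constraint n) m) →
    #proper C A ((i , i , false) ∷ᵥ cs) ≡ #proper C (updateAt A i withoutZero) cs
  #proper-loop⁻ {n} A i cs = ∑ᵛ-cong C n λ κ → begin
    weight A κ * (𝟙 (satisfies κ (i , i , false)) * satisfiesAll cs κ)
      ≡⟨ cong (λ b → weight A κ * (𝟙 (not b) * satisfiesAll cs κ)) (self-negative (lookup κ i)) ⟩
    weight A κ * (𝟙 (not (isZero (lookup κ i))) * satisfiesAll cs κ)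
      ≡⟨ ℤP.*-assoc (weight A κ) (𝟙 (not (isZero (lookup κ i)))) (satisfiesAll cs κ) ⟨
    weight A κ * 𝟙 (not (isZero (lookup κ i))) * satisfiesAll cs κ
      ≡⟨ cong (_* satisfiesAll cs κ) (weight-updateAt A i (λ c → not (isZero c)) κ) ⟨
    weight (updateAt A i withoutZero) κ * satisfiesAll cs κ ∎
    where
    open ≡-Reasoning
    self-negative : ∀ x → does (x ℤ.≟ sgn false * x) ≡ isZero x
    self-negative x = does-⇔ (mk⇔ (to x) (λ { refl → refl })) (x ℤ.≟ sgn false * x) (x ℤ.≟ + 0)
      where
      to : ∀ x → x ≡ sgn false * x → x ≡ + 0
      to (+ zero)    _ = refl
      to (+ suc n)   ()
      to ℤ.-[1+ n ] ()

  -- Summing over κ i first, only κ i = sgn s * κ j contributes, which is what contraction records.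
  #proper-merged : ∀ {n m} → Unique C → (A : Vector (ℤ → Bool) (suc n)) → ∀ {i j} (i≢j : i ≢ j) s
    (cs : Vec (Constraint (suc n)) m) → let j′ = punchOut i≢j in
    ∑ᵛ C (suc n) (λ κ → 𝟙 (does (lookup κ i ℤ.≟ sgn s * lookup κ j)) * (weight A κ * satisfiesAll cs κ)) ≡
      #proper C (contractAllowed C i j′ s A) (V.map (contractConstraint i j′ s) cs)
  #proper-merged {n} uC A {i} {j} i≢j s cs = begin
    ∑ᵛ C (suc n) (λ κ → 𝟙 (equal κ) * F κ)
      ≡⟨ ∑ᵛ-insertAt C n i (λ κ → 𝟙 (equal κ) * F κ) ⟩
    ∑[ c ∈ C ] ∑ᵛ C n (λ w → 𝟙 (equal (insertAt w i c)) * F (insertAt w i c))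
      ≡⟨ ∑-cong C (λ c → ∑ᵛ-cong C n λ w → cong (λ b → 𝟙 b * F (insertAt w i c)) (equal-insertAt w c)) ⟩
    ∑[ c ∈ C ] ∑ᵛ C n (λ w → 𝟙 (does (c ℤ.≟ sgn s * lookup w j′)) * F (insertAt w i c))
      ≡⟨ ∑ᵛ-∑ C C n _ ⟨
    ∑ᵛ C n (λ w → ∑[ c ∈ C ] 𝟙 (does (c ℤ.≟ sgn s * lookup w j′)) * F (insertAt w i c))
      ≡⟨ ∑ᵛ-cong C n (λ w → trans (∑-pick uC _ λ c → F (insertAt w i c)) (merged-term w)) ⟩
    #proper C (contractAllowed C i j′ s A) (V.map (contractConstraint i j′ s) cs) ∎
    where
    open ≡-Reasoning
    j′ = punchOut i≢j
    F : Vec ℤ (suc n) → ℤ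
    F κ = weight A κ * satisfiesAll cs κ
    equal : Vec ℤ (suc n) → Bool
    equal κ = does (lookup κ i ℤ.≟ sgn s * lookup κ j)
    equal-insertAt : ∀ w c → equal (insertAt w i c) ≡ does (c ℤ.≟ sgn s * lookup w j′)
    equal-insertAt w c = cong₂ (λ p q → does (p ℤ.≟ sgn s * q)) (VP.insertAt-lookup w i c)
      (trans (cong (lookup (insertAt w i c)) (sym (FP.punchIn-punchOut i≢j))) (VP.insertAt-punchIn w i c j′))
    merged-term : ∀ w → let t = sgn s * lookup w j′ in
      𝟙 (t ∈ᵇ C) * F (insertAt w i t) ≡
        weight (contractAllowed C i j′ s A) w * satisfiesAll (V.map (contractConstraint i j′ s) cs) w
    merged-term w = begin
      𝟙 (t ∈ᵇ C) * (weight A (insertAt w i t) * satisfiesAll cs (insertAt w i t))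
        ≡⟨ cong₂ (λ p q → 𝟙 (t ∈ᵇ C) * (p * q)) (weight-insertAt A w i t) (satisfiesAll-merged i j′ s w cs) ⟩
      𝟙 (t ∈ᵇ C) * (𝟙 (A i t) * weight (removeAt A i) w * S)
        ≡⟨ solve 4 (λ a b r q → a :* (b :* r :* q) := r :* (a :* b) :* q)
                 refl (𝟙 (t ∈ᵇ C)) (𝟙 (A i t)) (weight (removeAt A i) w) S ⟩
      weight (removeAt A i) w * (𝟙 (t ∈ᵇ C) * 𝟙 (A i t)) * S
        ≡⟨ cong (λ u → weight (removeAt A i) w * u * S) (𝟙-∧ (t ∈ᵇ C) (A i t)) ⟨
      weight (removeAt A i) w * 𝟙 ((t ∈ᵇ C) ∧ A i t) * S
        ≡⟨ cong (_* S) (weight-updateAt (removeAt A i) j′ (λ c → (sgn s * c ∈ᵇ C) ∧ A i (sgn s * c)) w) ⟨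
      weight (contractAllowed C i j′ s A) w * S ∎
      where
      t = sgn s * lookup w j′
      S = satisfiesAll (V.map (contractConstraint i j′ s) cs) w

  #proper-contract : ∀ {n m} → Unique C → (A : Vector (ℤ → Bool) (suc n)) → ∀ {i j} (i≢j : i ≢ j) s
    (cs : Vec (Constraint (suc n)) m) → let j′ = punchOut i≢j in
    #proper C A ((i , j , s) ∷ᵥ cs) ≡
      #proper C A cs - #proper C (contractAllowed C i j′ s A) (V.map (contractConstraint i j′ s) cs)
  #proper-contract {n} uC A {i} {j} i≢j s cs = begin
    ∑ᵛ C (suc n) (λ κ → weight A κ * (𝟙 (not (equal κ)) * satisfiesAll cs κ))
      ≡⟨ ∑ᵛ-cong C (suc n) split ⟩
    ∑ᵛ C (suc n) (λ κ → F κ - 𝟙 (equal κ) * F κ)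
      ≡⟨ ∑ᵛ-− C (suc n) F (λ κ → 𝟙 (equal κ) * F κ) ⟩
    #proper C A cs - ∑ᵛ C (suc n) (λ κ → 𝟙 (equal κ) * F κ)
      ≡⟨ cong (λ e → #proper C A cs - e) (#proper-merged uC A i≢j s cs) ⟩
    #proper C A cs - #proper C (contractAllowed C i j′ s A) (V.map (contractConstraint i j′ s) cs) ∎
    where
    open ≡-Reasoning
    j′ = punchOut i≢j
    F : Vec ℤ (suc n) → ℤ
    F κ = weight A κ * satisfiesAll cs κ
    equal : Vec ℤ (suc n) → Bool
    equal κ = does (lookup κ i ℤ.≟ sgn s * lookup κ j)
    split : ∀ κ → weight A κ * (𝟙 (not (equal κ)) * satisfiesAll cs κ) ≡ F κ - 𝟙 (equal κ) * F κ
    split κ rewrite 𝟙-not (equal κ) =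
      solve 3 (λ w e r → w :* ((con (+ 1) :- e) :* r) := w :* r :- e :* (w :* r))
              refl (weight A κ) (𝟙 (equal κ)) (satisfiesAll cs κ)

-- The colouring polynomial

-- Relative to C, a colour c ∈ C is zero, paired (-c ∈ C) or unpaired; a domain says which are allowed.
record Domain : Set where
  constructor domain
  field
    onZero onPaired onUnpaired : Bool
open Domain

accepts : Domain → (zero? paired? : Bool) → Bool
accepts D true  _     = onZero D
accepts D false true  = onPaired D
accepts D false false = onUnpaired D

⟦_⟧ : Domain → List ℤ → ℤ → Bool
⟦ D ⟧ C c = (c ∈ᵇ C) ∧ accepts D (isZero c) (- c ∈ᵇ C)

full : Domain
full = domain true true true

nonzero : Domain → Domain
nonzero D = domain false (onPaired D) (onUnpaired D)

-- the domain of j after identifying κ i with sgn s * κ j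
meet : Bool → Domain → Domain → Domain
meet true  Di Dj = domain (onZero Dj ∧ onZero Di) (onPaired Dj ∧ onPaired Di) (onUnpaired Dj ∧ onUnpaired Di)
meet false Di Dj = domain (onZero Dj ∧ onZero Di) (onPaired Dj ∧ onPaired Di) false

⟦nonzero⟧ : ∀ D C c → ⟦ nonzero D ⟧ C c ≡ withoutZero (⟦ D ⟧ C) c
⟦nonzero⟧ D C c = trans (cong ((c ∈ᵇ C) ∧_) (accepts-nonzero (isZero c) (- c ∈ᵇ C)))
                        (sym (BP.∧-assoc (c ∈ᵇ C) _ _))
  where
  accepts-nonzero : ∀ z b → accepts (nonzero D) z b ≡ accepts D z b ∧ not z
  accepts-nonzero true  b     = sym (BP.∧-zeroʳ (onZero D))
  accepts-nonzero false true  = sym (BP.∧-identityʳ (onPaired D))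
  accepts-nonzero false false = sym (BP.∧-identityʳ (onUnpaired D))

isZero-neg : ∀ x → isZero (- x) ≡ isZero x
isZero-neg (+ zero)    = refl
isZero-neg (+ suc n)   = refl
isZero-neg ℤ.-[1+ n ] = refl

⟦meet⟧ : ∀ s Di Dj C c → ⟦ meet s Di Dj ⟧ C c ≡ mergeAllowed C s (⟦ Di ⟧ C) (⟦ Dj ⟧ C) c
⟦meet⟧ true Di Dj C c rewrite ℤP.*-identityˡ c with c ∈ᵇ C
... | false = refl
... | true  = accepts-meet (isZero c) (- c ∈ᵇ C)
  where
  accepts-meet : ∀ z b → accepts (meet true Di Dj) z b ≡ accepts Dj z b ∧ accepts Di z b
  accepts-meet true  b     = refl
  accepts-meet false true  = refl
  accepts-meet false false = refl
⟦meet⟧ false Di Dj C c rewrite ℤP.-1*i≡-i c | isZero-neg c | ℤP.neg-involutive c with c ∈ᵇ C in c∈C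
... | false = refl
... | true  = accepts-meet (isZero c) (- c ∈ᵇ C) zero⇒paired
  where
  zero⇒paired : isZero c ≡ true → - c ∈ᵇ C ≡ true
  zero⇒paired c≡0 with c ℤ.≟ + 0
  ... | yes refl = c∈C
  accepts-meet : ∀ z b → (z ≡ true → b ≡ true) →
    accepts (meet false Di Dj) z b ≡ accepts Dj z b ∧ (b ∧ (b ∧ accepts Di z true))
  accepts-meet true  b     z⇒b rewrite z⇒b refl = refl
  accepts-meet false true  _ = refl
  accepts-meet false false _ = sym (BP.∧-zeroʳ (onUnpaired Dj))

-- The size of ⟦ D ⟧ C when |C| = x, C has y unpaired colours, and 0 ∈ C iff ε.
sizeM : Bool → Domain → MPoly
sizeM ε D = (if onZero D then (𝟙 ε , 0 , 0) ∷ [] else [])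
         ++ (if onPaired D then (+ 1 , 1 , 0) ∷ (- + 1 , 0 , 1) ∷ (- 𝟙 ε , 0 , 0) ∷ [] else [])
         ++ (if onUnpaired D then (+ 1 , 0 , 1) ∷ [] else [])

evalM-sizeM : ∀ ε D x y →
  evalM (sizeM ε D) x y ≡ 𝟙 (onZero D) * 𝟙 ε + 𝟙 (onPaired D) * (x - y - 𝟙 ε) + 𝟙 (onUnpaired D) * y
evalM-sizeM ε (domain z p u) x y = begin
  evalM (Z ++ P ++ U) x y                              ≡⟨ evalM-++ Z (P ++ U) x y ⟩
  evalM Z x y + evalM (P ++ U) x y                     ≡⟨ cong (λ e → evalM Z x y + e) (evalM-++ P U x y) ⟩
  evalM Z x y + (evalM P x y + evalM U x y)
    ≡⟨ cong₂ (λ a b → a + (b + evalM U x y)) (evalM-if z) (evalM-if p) ⟩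
  𝟙 z * ez + (𝟙 p * ep + evalM U x y)                  ≡⟨ cong (λ e → 𝟙 z * ez + (𝟙 p * ep + e)) (evalM-if u) ⟩
  𝟙 z * ez + (𝟙 p * ep + 𝟙 u * eu)                     ≡⟨ solve 6 (λ z p u e x y →
                                                             z :* (e :* (con (+ 1) :* con (+ 1)) :+ con (+ 0))
                                                             :+ (p :* (con (+ 1) :* (x :* con (+ 1) :* con (+ 1))
                                                                        :+ (con (- + 1) :* (con (+ 1) :* (y :* con (+ 1)))
                                                                        :+ (:- e :* (con (+ 1) :* con (+ 1)) :+ con (+ 0))))
                                                             :+ u :* (con (+ 1) :* (con (+ 1) :* (y :* con (+ 1))) :+ con (+ 0)))
                                                             := z :* e :+ p :* (x :- y :- e) :+ u :* y)
                                                           refl (𝟙 z) (𝟙 p) (𝟙 u) (𝟙 ε) x y ⟩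
  𝟙 z * 𝟙 ε + 𝟙 p * (x - y - 𝟙 ε) + 𝟙 u * y           ∎
  where
  open ≡-Reasoning
  Z = if z then (𝟙 ε , 0 , 0) ∷ [] else []
  P = if p then (+ 1 , 1 , 0) ∷ (- + 1 , 0 , 1) ∷ (- 𝟙 ε , 0 , 0) ∷ [] else []
  U = if u then (+ 1 , 0 , 1) ∷ [] else []
  ez = evalM ((𝟙 ε , 0 , 0) ∷ []) x y
  ep = evalM ((+ 1 , 1 , 0) ∷ (- + 1 , 0 , 1) ∷ (- 𝟙 ε , 0 , 0) ∷ []) x y
  eu = evalM ((+ 1 , 0 , 1) ∷ []) x y
  evalM-if : ∀ {M} b → evalM (if b then M else []) x y ≡ 𝟙 b * evalM M x y
  evalM-if {M} true  = sym (ℤP.*-identityˡ (evalM M x y))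
  evalM-if     false = refl

sizeOf : List ℤ → Domain → ℤ
sizeOf C D = ∑[ c ∈ C ] 𝟙 (⟦ D ⟧ C c)

contractDomains : ∀ {n} → Fin (suc n) → Fin n → Bool → Vector Domain (suc n) → Vector Domain n
contractDomains i j′ s d = updateAt (removeAt d i) j′ (meet s (d i))

module _ (ε : Bool) where

  productM : ∀ {n} → Vector Domain n → MPoly
  productM {zero}  d = oneM
  productM {suc n} d = mulM (sizeM ε (head d)) (productM (tail d))

  colouringM : ∀ {m n} → Vector Domain n → Vec (Constraint n) m → MPoly
  colouringM {zero}          d []ᵥ = productM d
  colouringM {suc m} {zero}  d ((() , _) ∷ᵥ cs)
  colouringM {suc m} {suc n} d ((i , j , s) ∷ᵥ cs) with i F.≟ j
  ... | yes _   = if s then [] else colouringM (updateAt d i nonzero) cs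
  ... | no i≢j = colouringM d cs −ₘ colouringM (contractDomains i j′ s d) (V.map (contractConstraint i j′ s) cs)
    where j′ = punchOut i≢j

  evalM-productM : ∀ {n} (d : Vector Domain n) x y → evalM (productM d) x y ≡ ∏ λ v → evalM (sizeM ε (d v)) x y
  evalM-productM {zero}  d x y = refl
  evalM-productM {suc n} d x y =
    trans (evalM-mul (sizeM ε (head d)) (productM (tail d)) x y)
          (cong (λ e → evalM (sizeM ε (head d)) x y * e) (evalM-productM (tail d) x y))

⟦updateAt⟧ : ∀ {n} C (d : Vector Domain n) j f g → (∀ D c → ⟦ f D ⟧ C c ≡ g (⟦ D ⟧ C) c) →
  ∀ v c → ⟦ updateAt d j f v ⟧ C c ≡ updateAt (λ v → ⟦ d v ⟧ C) j g v c
⟦updateAt⟧ C d j f g f≗g v c with j F.≟ v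
... | yes refl rewrite updateAt-updates j {f} d | updateAt-updates j {g} (λ v → ⟦ d v ⟧ C) = f≗g (d j) c
... | no j≢v  rewrite updateAt-minimal v j {f} d (λ v≡j → j≢v (sym v≡j))
                    | updateAt-minimal v j {g} (λ v → ⟦ d v ⟧ C) (λ v≡j → j≢v (sym v≡j)) = refl

module _ (C : List ℤ) (uC : Unique C) (ε : Bool) (x y : ℤ)
         (sizes : ∀ D → sizeOf C D ≡ evalM (sizeM ε D) x y) where

  #proper≡colouringM : ∀ {m n} (d : Vector Domain n) (cs : Vec (Constraint n) m) →
    #proper C (λ v → ⟦ d v ⟧ C) cs ≡ evalM (colouringM ε d cs) x y
  #proper≡colouringM {zero} d []ᵥ = begin
    #proper C (λ v → ⟦ d v ⟧ C) []ᵥ        ≡⟨ #proper-[] C (λ v → ⟦ d v ⟧ C) ⟩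
    ∏ (λ v → sizeOf C (d v))              ≡⟨ ∏-cong (λ v → sizes (d v)) ⟩
    ∏ (λ v → evalM (sizeM ε (d v)) x y)   ≡⟨ evalM-productM ε d x y ⟨
    evalM (productM ε d) x y              ∎
    where
    open ≡-Reasoning
  #proper≡colouringM {suc m} {zero}  d ((() , _) ∷ᵥ cs)
  #proper≡colouringM {suc m} {suc n} d ((i , j , s) ∷ᵥ cs) with i F.≟ j | s
  ... | yes refl | true  = #proper-loop⁺ C (λ v → ⟦ d v ⟧ C) i cs
  ... | yes refl | false = begin
    #proper C (λ v → ⟦ d v ⟧ C) ((i , i , false) ∷ᵥ cs)
      ≡⟨ #proper-loop⁻ C (λ v → ⟦ d v ⟧ C) i cs ⟩
    #proper C (updateAt (λ v → ⟦ d v ⟧ C) i withoutZero) cs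
      ≡⟨ #proper-cong C (λ v c → sym (⟦updateAt⟧ C d i nonzero withoutZero (λ D → ⟦nonzero⟧ D C) v c)) cs ⟩
    #proper C (λ v → ⟦ updateAt d i nonzero v ⟧ C) cs
      ≡⟨ #proper≡colouringM (updateAt d i nonzero) cs ⟩
    evalM (colouringM ε (updateAt d i nonzero) cs) x y                          ∎
    where open ≡-Reasoning
  ... | no i≢j | s = begin
    #proper C A ((i , j , s) ∷ᵥ cs)                                   ≡⟨ #proper-contract C uC A i≢j s cs ⟩
    #proper C A cs - #proper C (contractAllowed C i j′ s A) cs′
      ≡⟨ cong (λ e → #proper C A cs - e) (#proper-cong C contracted cs′) ⟩
    #proper C A cs - #proper C (λ v → ⟦ d′ v ⟧ C) cs′
      ≡⟨ cong₂ _-_ (#proper≡colouringM d cs) (#proper≡colouringM d′ cs′) ⟩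
    evalM (colouringM ε d cs) x y - evalM (colouringM ε d′ cs′) x y   ≡⟨ evalM-− (colouringM ε d cs) _ x y ⟨
    evalM (colouringM ε d cs −ₘ colouringM ε d′ cs′) x y              ∎
    where
    open ≡-Reasoning
    A = λ v → ⟦ d v ⟧ C
    j′ = punchOut i≢j
    d′ = contractDomains i j′ s d
    cs′ = V.map (contractConstraint i j′ s) cs
    contracted : ∀ v c → contractAllowed C i j′ s A v c ≡ ⟦ d′ v ⟧ C c
    contracted v c = sym (⟦updateAt⟧ C (removeAt d i) j′ (meet s (d i)) (mergeAllowed C s (A i)) (λ D → ⟦meet⟧ s (d i) D C) v c)

-- Top coefficients

DegreeAtMost-sizeM : ∀ ε D → DegreeAtMost 1 (sizeM ε D)
DegreeAtMost-sizeM ε (domain z p u) =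
  AllP.++⁺ (if-deg z (z≤n ∷ [])) (AllP.++⁺ (if-deg p (s≤s z≤n ∷ s≤s z≤n ∷ z≤n ∷ [])) (if-deg u (s≤s z≤n ∷ [])))
  where
  if-deg : ∀ {M} b → DegreeAtMost 1 M → DegreeAtMost 1 (if b then M else [])
  if-deg true  h = h
  if-deg false h = []

module _ (ε : Bool) where

  DegreeAtMost-productM : ∀ {n} (d : Vector Domain n) → DegreeAtMost n (productM ε d)
  DegreeAtMost-productM {zero}  d = z≤n ∷ []
  DegreeAtMost-productM {suc n} d = DegreeAtMost-mul (DegreeAtMost-sizeM ε (head d)) (DegreeAtMost-productM (tail d))

  DegreeAtMost-colouringM : ∀ {m n} (d : Vector Domain n) (cs : Vec (Constraint n) m) → DegreeAtMost n (colouringM ε d cs)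
  DegreeAtMost-colouringM {zero}          d []ᵥ = DegreeAtMost-productM d
  DegreeAtMost-colouringM {suc m} {zero}  d ((() , _) ∷ᵥ cs)
  DegreeAtMost-colouringM {suc m} {suc n} d ((i , j , s) ∷ᵥ cs) with i F.≟ j | s
  ... | yes _   | true  = []
  ... | yes _   | false = DegreeAtMost-colouringM (updateAt d i nonzero) cs
  ... | no i≢j | s     = DegreeAtMost-− (DegreeAtMost-colouringM d cs)
    (DegreeAtMost-mono (ℕP.n≤1+n n) (DegreeAtMost-colouringM (contractDomains i j′ s d) (V.map (contractConstraint i j′ s) cs)))
    where j′ = punchOut i≢j

AgreeFromDegree : ℕ → MPoly → MPoly → Set
AgreeFromDegree k M N = ∀ i j → k ℕ.≤ i ℕ.+ j → coeffM M i j ≡ coeffM N i j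

ends : ∀ {n} → Constraint n → Fin n × Fin n
ends (a , b , _) = a , b

Loopless : ∀ {n m} → Vec (Constraint n) m → Set
Loopless = Allᵥ.All λ e → proj₁ (ends e) ≢ proj₂ (ends e)

-- Removing the constraints changes only terms of degree < n, since contraction loses a vertex.
colouringM-loopless : ∀ ε {m n} (d : Vector Domain n) (cs : Vec (Constraint n) m) → Loopless cs →
  AgreeFromDegree n (colouringM ε d cs) (productM ε d)
colouringM-loopless ε                 d []ᵥ              _                 i′ j′ _ = refl
colouringM-loopless ε {suc m} {zero}  d ((() , _) ∷ᵥ cs) _
colouringM-loopless ε {suc m} {suc n} d ((i , j , s) ∷ᵥ cs) (i≢j ∷ᵥ loopless) i′ j′ n≤i′+j′ with i F.≟ j
... | yes i≡j = contradiction i≡j i≢j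
... | no i≢j = begin
  coeffM (colouringM ε d cs −ₘ contracted) i′ j′
    ≡⟨ coeffM-− (colouringM ε d cs) contracted i′ j′ ⟩
  coeffM (colouringM ε d cs) i′ j′ - coeffM contracted i′ j′
    ≡⟨ cong₂ _-_ (colouringM-loopless ε d cs loopless i′ j′ n≤i′+j′)
                 (coeffM-beyond-degree (DegreeAtMost-colouringM ε d′ cs′) i′ j′ n≤i′+j′) ⟩
  coeffM (productM ε d) i′ j′ - + 0                               ≡⟨ ℤP.+-identityʳ _ ⟩
  coeffM (productM ε d) i′ j′                                     ∎
  where
  open ≡-Reasoning
  d′ = contractDomains i (punchOut i≢j) s d
  cs′ = V.map (contractConstraint i (punchOut i≢j) s) cs
  contracted = colouringM ε d′ cs′

Ordered : ∀ {n} → Constraint n → Set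
Ordered e = toℕ (proj₁ (ends e)) ℕ.< toℕ (proj₂ (ends e))

Simple : ∀ {n m} → Vec (Constraint n) m → Set
Simple cs = Allᵥ.All Ordered cs × AllPairsᵥ.AllPairs (λ e e′ → ends e ≢ ends e′) cs

relabel-injective : ∀ {n} {i j : Fin (suc n)} (i≢j : i ≢ j) s → toℕ i ℕ.< toℕ j →
  ∀ {a b} → toℕ a ℕ.< toℕ b → (i , j) ≢ (a , b) →
  proj₁ (relabel i (punchOut i≢j) s a) ≢ proj₁ (relabel i (punchOut i≢j) s b)
relabel-injective {i = i} {j} i≢j s i<j {a} {b} a<b ij≢ab with i F.≟ a | i F.≟ b
... | yes refl | yes refl = λ _ → ℕP.<-irrefl refl a<b
... | yes refl | no i≢b  = λ j′≡b′ → ij≢ab (cong (i ,_) (FP.punchOut-injective i≢j i≢b j′≡b′))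
... | no i≢a  | yes refl = λ a′≡j′ → ℕP.<-asym i<j (subst (λ v → toℕ v ℕ.< toℕ i) (FP.punchOut-injective i≢a i≢j a′≡j′) a<b)
... | no i≢a  | no i≢b  = λ a′≡b′ → ℕP.<-irrefl (cong toℕ (FP.punchOut-injective i≢a i≢b a′≡b′)) a<b

-- A simple system has no second constraint on {i, j}, so contracting ij creates no loop.
contract-loopless : ∀ {n m} {i j : Fin (suc n)} (i≢j : i ≢ j) s → toℕ i ℕ.< toℕ j →
  (cs : Vec (Constraint (suc n)) m) → Allᵥ.All Ordered cs → Allᵥ.All (λ e → (i , j) ≢ ends e) cs →
  Loopless (V.map (contractConstraint i (punchOut i≢j) s) cs)
contract-loopless i≢j s i<j []ᵥ               []ᵥ           []ᵥ                = []ᵥ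
contract-loopless i≢j s i<j ((a , b , t) ∷ᵥ cs) (a<b ∷ᵥ ords) (ij≢ab ∷ᵥ others) =
  relabel-injective i≢j s i<j a<b ij≢ab ∷ᵥ contract-loopless i≢j s i<j cs ords others

δ-refl : ∀ a c → δ a a c ≡ c
δ-refl zero    c = refl
δ-refl (suc a) c = δ-refl a c

-- the product of the sizes x, …, x and x (s positive) or x − y (s negative) left by contracting one edge
mergedM : Bool → ℕ → MPoly
mergedM s k = (+ 1 , suc k , 0) ∷ (if s then [] else (- + 1 , k , 1) ∷ [])

module _ (ε : Bool) where

  evalM-sizeM-full : ∀ x y → evalM (sizeM ε full) x y ≡ x
  evalM-sizeM-full x y = trans (evalM-sizeM ε full x y)
    (solve 3 (λ e x y → con (+ 1) :* e :+ con (+ 1) :* (x :- y :- e) :+ con (+ 1) :* y := x) refl (𝟙 ε) x y)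

  coeffM-productM-full : ∀ {n} (d : Vector Domain n) → (∀ v → d v ≡ full) →
    ∀ i j → coeffM (productM ε d) i j ≡ coeffM ((+ 1 , n , 0) ∷ []) i j
  coeffM-productM-full {n} d d≡full = coeffM-from-evalM (productM ε d) ((+ 1 , n , 0) ∷ []) λ x y → begin
    evalM (productM ε d) (+ x) (+ y)                    ≡⟨ evalM-productM ε d (+ x) (+ y) ⟩
    ∏ (λ v → evalM (sizeM ε (d v)) (+ x) (+ y))
      ≡⟨ ∏-const _ (+ x) (λ v → trans (cong (λ D → evalM (sizeM ε D) (+ x) (+ y)) (d≡full v)) (evalM-sizeM-full (+ x) (+ y))) ⟩
    (+ x) ^ n
      ≡⟨ solve 1 (λ p → p := con (+ 1) :* (p :* con (+ 1)) :+ con (+ 0)) refl ((+ x) ^ n) ⟩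
    evalM ((+ 1 , n , 0) ∷ []) (+ x) (+ y)              ∎
    where open ≡-Reasoning

  coeffM-productM-merged : ∀ {k} (d : Vector Domain (suc k)) j s → d j ≡ meet s full full → (∀ v → v ≢ j → d v ≡ full) →
    ∀ i′ j′ → coeffM (productM ε d) i′ j′ ≡ coeffM (mergedM s k) i′ j′
  coeffM-productM-merged {k} d j s dj≡meet d≡full = coeffM-from-evalM (productM ε d) (mergedM s k) λ x y → begin
    evalM (productM ε d) (+ x) (+ y)                              ≡⟨ evalM-productM ε d (+ x) (+ y) ⟩
    ∏ (λ v → evalM (sizeM ε (d v)) (+ x) (+ y))
      ≡⟨ ∏-const-but-one _ (+ x) j (λ v v≢j → trans (cong (λ D → evalM (sizeM ε D) (+ x) (+ y)) (d≡full v v≢j)) (evalM-sizeM-full (+ x) (+ y))) ⟩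
    evalM (sizeM ε (d j)) (+ x) (+ y) * (+ x) ^ k
      ≡⟨ cong (λ D → evalM (sizeM ε D) (+ x) (+ y) * (+ x) ^ k) dj≡meet ⟩
    evalM (sizeM ε (meet s full full)) (+ x) (+ y) * (+ x) ^ k      ≡⟨ merged s (+ x) (+ y) ⟩
    evalM (mergedM s k) (+ x) (+ y)                               ∎
    where
    open ≡-Reasoning
    merged : ∀ s x y → evalM (sizeM ε (meet s full full)) x y * x ^ k ≡ evalM (mergedM s k) x y
    merged true x y = trans (cong (_* x ^ k) (evalM-sizeM-full x y))
      (solve 2 (λ x p → x :* p := con (+ 1) :* (x :* p :* con (+ 1)) :+ con (+ 0)) refl x (x ^ k))
    merged false x y = trans (cong (_* x ^ k) (evalM-sizeM ε (meet false full full) x y))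
      (solve 4 (λ e x y p → (con (+ 1) :* e :+ con (+ 1) :* (x :- y :- e) :+ con (+ 0) :* y) :* p
                             := con (+ 1) :* (x :* p :* con (+ 1)) :+ (con (- + 1) :* (p :* (y :* con (+ 1))) :+ con (+ 0)))
             refl (𝟙 ε) x y (x ^ k))

  contracted-agrees-with-mergedM : ∀ {m k} (d : Vector Domain (suc (suc k))) → (∀ v → d v ≡ full) →
    ∀ {i j} (i≢j : i ≢ j) s → toℕ i ℕ.< toℕ j → (cs : Vec (Constraint (suc (suc k))) m) →
    Allᵥ.All Ordered cs → Allᵥ.All (λ e → (i , j) ≢ ends e) cs →
    AgreeFromDegree (suc k) (colouringM ε (contractDomains i (punchOut i≢j) s d) (V.map (contractConstraint i (punchOut i≢j) s) cs))
                            (mergedM s k)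
  contracted-agrees-with-mergedM d d≡full {i} i≢j s i<j cs ords others a b k≤a+b =
    trans (colouringM-loopless ε d′ _ (contract-loopless i≢j s i<j cs ords others) a b k≤a+b)
          (coeffM-productM-merged d′ j′ s d′j′≡meet d′≡full a b)
    where
    j′ = punchOut i≢j
    d′ = contractDomains i j′ s d
    d′j′≡meet : d′ j′ ≡ meet s full full
    d′j′≡meet = trans (updateAt-updates j′ (removeAt d i)) (cong₂ (meet s) (d≡full i) (d≡full (punchIn i j′)))
    d′≡full : ∀ v → v ≢ j′ → d′ v ≡ full
    d′≡full v v≢j′ = trans (updateAt-minimal v j′ (removeAt d i) v≢j′) (d≡full (punchIn i v))

#negative : ∀ {n m} → Vec (Constraint n) m → ℕ
#negative []ᵥ                 = 0
#negative ((_ , _ , s) ∷ᵥ cs) = if s then #negative cs else suc (#negative cs)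

module _ (ε : Bool) where

  coeffM-colouringM-xⁿ⁻¹ : ∀ {m n} (d : Vector Domain (suc n)) (cs : Vec (Constraint (suc n)) m) →
    (∀ v → d v ≡ full) → Simple cs → coeffM (colouringM ε d cs) n 0 ≡ - + m
  coeffM-colouringM-xⁿ⁻¹ {n = n} d []ᵥ d≡full _ =
    trans (coeffM-productM-full ε d d≡full n 0) (cong (_+ + 0) (δ-≢ (+ 1) (ℕP.1+n≢n {n})))
  coeffM-colouringM-xⁿ⁻¹ {n = zero}  d ((F.zero , F.zero , s) ∷ᵥ cs) _ ((() ∷ᵥ _) , _)
  coeffM-colouringM-xⁿ⁻¹ {suc m} {suc k} d ((i , j , s) ∷ᵥ cs) d≡full ((i<j ∷ᵥ ords) , (others ∷ᵥ pairs)) with i F.≟ j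
  ... | yes refl = contradiction i<j (ℕP.<-irrefl refl)
  ... | no i≢j  = begin
    coeffM (colouringM ε d cs −ₘ B) (suc k) 0               ≡⟨ coeffM-− (colouringM ε d cs) B (suc k) 0 ⟩
    coeffM (colouringM ε d cs) (suc k) 0 - coeffM B (suc k) 0
      ≡⟨ cong₂ _-_ (coeffM-colouringM-xⁿ⁻¹ d cs d≡full (ords , pairs))
                   (contracted-agrees-with-mergedM ε d d≡full i≢j s i<j cs ords others (suc k) 0 (ℕP.m≤m+n (suc k) 0)) ⟩
    - + m - coeffM (mergedM s k) (suc k) 0                 ≡⟨ cong (λ e → - + m - e) (mergedM-xᵏ⁺¹ s) ⟩
    - + m - + 1
      ≡⟨ solve 1 (λ m → :- m :- con (+ 1) := :- (con (+ 1) :+ m)) refl (+ m) ⟩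
    - + suc m                                              ∎
    where
    open ≡-Reasoning
    B = colouringM ε (contractDomains i (punchOut i≢j) s d) (V.map (contractConstraint i (punchOut i≢j) s) cs)
    mergedM-xᵏ⁺¹ : ∀ s → coeffM (mergedM s k) (suc k) 0 ≡ + 1
    mergedM-xᵏ⁺¹ true  = cong (_+ + 0) (δ-refl k (+ 1))
    mergedM-xᵏ⁺¹ false = cong₂ (λ a b → a + (b + + 0)) (δ-refl k (+ 1)) (δ-≢ (δ 1 0 (- + 1)) (ℕP.<⇒≢ (ℕP.n<1+n k)))

  coeffM-colouringM-xⁿ⁻²y : ∀ {m k} (d : Vector Domain (suc (suc k))) (cs : Vec (Constraint (suc (suc k))) m) →
    (∀ v → d v ≡ full) → Simple cs → coeffM (colouringM ε d cs) k 1 ≡ + #negative cs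
  coeffM-colouringM-xⁿ⁻²y {k = k} d []ᵥ d≡full _ =
    trans (coeffM-productM-full ε d d≡full k 1) (cong (_+ + 0) (δ-≢ (+ 0) (ℕP.>⇒≢ (ℕP.m<n⇒m<1+n (ℕP.n<1+n k)))))
  coeffM-colouringM-xⁿ⁻²y {suc m} {k} d ((i , j , s) ∷ᵥ cs) d≡full ((i<j ∷ᵥ ords) , (others ∷ᵥ pairs)) with i F.≟ j
  ... | yes refl = contradiction i<j (ℕP.<-irrefl refl)
  ... | no i≢j  = begin
    coeffM (colouringM ε d cs −ₘ B) k 1                ≡⟨ coeffM-− (colouringM ε d cs) B k 1 ⟩
    coeffM (colouringM ε d cs) k 1 - coeffM B k 1
      ≡⟨ cong₂ _-_ (coeffM-colouringM-xⁿ⁻²y d cs d≡full (ords , pairs))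
                   (contracted-agrees-with-mergedM ε d d≡full i≢j s i<j cs ords others k 1 (ℕP.≤-reflexive (ℕP.+-comm 1 k))) ⟩
    + #negative cs - coeffM (mergedM s k) k 1          ≡⟨ negatives s ⟩
    + #negative ((i , j , s) ∷ᵥ cs)                    ∎
    where
    open ≡-Reasoning
    B = colouringM ε (contractDomains i (punchOut i≢j) s d) (V.map (contractConstraint i (punchOut i≢j) s) cs)
    δ-suc : ∀ c → δ (suc k) k c ≡ + 0
    δ-suc c = δ-≢ c (ℕP.>⇒≢ (ℕP.n<1+n k))
    negatives : ∀ s → + #negative cs - coeffM (mergedM s k) k 1 ≡ + #negative ((i , j , s) ∷ᵥ cs)
    negatives true  rewrite δ-suc (+ 0) = ℤP.+-identityʳ (+ #negative cs)
    negatives false rewrite δ-suc (+ 0) | δ-refl k (- + 1) =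
      solve 1 (λ n → n :- (con (+ 0) :+ (con (- + 1) :+ con (+ 0))) := con (+ 1) :+ n) refl (+ #negative cs)

Positive : ∀ {n m} → Vec (Constraint n) m → Set
Positive = Allᵥ.All λ e → proj₂ (proj₂ e) ≡ true

relabel-positive : ∀ {n} (i : Fin (suc n)) j′ v → proj₂ (relabel i j′ true v) ≡ true
relabel-positive i j′ v with i F.≟ v
... | yes _ = refl
... | no _  = refl

contract-positive : ∀ {n m} (i : Fin (suc n)) j′ (cs : Vec (Constraint (suc n)) m) →
  Positive cs → Positive (V.map (contractConstraint i j′ true) cs)
contract-positive i j′ []ᵥ               []ᵥ              = []ᵥ
contract-positive i j′ ((a , b , t) ∷ᵥ cs) (refl ∷ᵥ pos) =
  cong₂ (λ p q → p ·ₛ (true ·ₛ q)) (relabel-positive i j′ a) (relabel-positive i j′ b) ∷ᵥ contract-positive i j′ cs pos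

contractDomains-full : ∀ {n} (i : Fin (suc n)) j′ (d : Vector Domain (suc n)) → (∀ v → d v ≡ full) →
  ∀ v → contractDomains i j′ true d v ≡ full
contractDomains-full i j′ d d≡full v with j′ F.≟ v
... | yes refl = trans (updateAt-updates j′ (removeAt d i)) (cong₂ (meet true) (d≡full i) (d≡full (punchIn i j′)))
... | no j′≢v = trans (updateAt-minimal v j′ (removeAt d i) (λ v≡j′ → j′≢v (sym v≡j′))) (d≡full (punchIn i v))

-- With only positive constraints every domain stays full, so only the size x of C matters.
colouringM-positive : ∀ ε ε′ {m n} (d : Vector Domain n) (cs : Vec (Constraint n) m) → (∀ v → d v ≡ full) → Positive cs →
  ∀ x y y′ → evalM (colouringM ε d cs) x y ≡ evalM (colouringM ε′ d cs) x y′
colouringM-positive ε ε′ {n = n} d []ᵥ d≡full _ x y y′ = begin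
  evalM (productM ε d) x y                       ≡⟨ evalM-productM ε d x y ⟩
  ∏ (λ v → evalM (sizeM ε (d v)) x y)
    ≡⟨ ∏-const _ x (λ v → trans (cong (λ D → evalM (sizeM ε D) x y) (d≡full v)) (evalM-sizeM-full ε x y)) ⟩
  x ^ n
    ≡⟨ ∏-const _ x (λ v → trans (cong (λ D → evalM (sizeM ε′ D) x y′) (d≡full v)) (evalM-sizeM-full ε′ x y′)) ⟨
  ∏ (λ v → evalM (sizeM ε′ (d v)) x y′)          ≡⟨ evalM-productM ε′ d x y′ ⟨
  evalM (productM ε′ d) x y′                     ∎
  where open ≡-Reasoning
colouringM-positive ε ε′ {suc m} {zero}  d ((() , _) ∷ᵥ cs)
colouringM-positive ε ε′ {suc m} {suc n} d ((i , j , true) ∷ᵥ cs) d≡full (refl ∷ᵥ pos) x y y′ with i F.≟ j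
... | yes _   = refl
... | no i≢j = begin
  evalM (colouringM ε d cs −ₘ colouringM ε d′ cs′) x y
    ≡⟨ evalM-− (colouringM ε d cs) (colouringM ε d′ cs′) x y ⟩
  evalM (colouringM ε d cs) x y - evalM (colouringM ε d′ cs′) x y       ≡⟨ cong₂ _-_ (colouringM-positive ε ε′ d cs d≡full pos x y y′)
                                                                             (colouringM-positive ε ε′ d′ cs′ (contractDomains-full i j′ d d≡full)
                                                                                (contract-positive i j′ cs pos) x y y′) ⟩
  evalM (colouringM ε′ d cs) x y′ - evalM (colouringM ε′ d′ cs′) x y′
    ≡⟨ evalM-− (colouringM ε′ d cs) (colouringM ε′ d′ cs′) x y′ ⟨
  evalM (colouringM ε′ d cs −ₘ colouringM ε′ d′ cs′) x y′               ∎
  where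
  open ≡-Reasoning
  j′ = punchOut i≢j
  d′ = contractDomains i j′ true d
  cs′ = V.map (contractConstraint i j′ true) cs

zeros : Bool → List ℤ
zeros false = []
zeros true  = + 0 ∷ []

bit : Bool → ℕ
bit false = 0
bit true  = 1

-- C = {0 | ε} ∪ P ∪ U with |P| = 2k and |U| = μ, as in the definition of a (λ, μ)-colour set
record ColourSetData (λ′ μ : ℕ) (C : List ℤ) : Set where
  field
    ε      : Bool
    k      : ℕ
    λ≡     : λ′ ≡ μ ℕ.+ (bit ε ℕ.+ 2 ℕ.* k)
    unique : Unique C
    sizes  : ∀ D → sizeOf C D ≡ evalM (sizeM ε D) (+ λ′) (+ μ)

∈ᵇ-true : ∀ {c C} → c ∈ C → c ∈ᵇ C ≡ true
∈ᵇ-true {c} {C} = dec-true (c ∈? C)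

∈ᵇ-false : ∀ {c C} → c ∉ C → c ∈ᵇ C ≡ false
∈ᵇ-false {c} {C} = dec-false (c ∈? C)

module FromParts (C P U : List ℤ) (ε : Bool) (C↭ : C ↭ zeros ε ++ (P ++ U))
  (uP : Unique P) (uU : Unique U) (nzP : All NonZero P) (nzU : All NonZero U)
  (symP : ∀ x → x ∈ P → - x ∈ P) (P∩U : ∀ x → x ∈ P → x ∉ U) (negU : ∀ x → x ∈ U → - x ∉ U) where

  private
    from : ∀ {c} → c ∈ zeros ε ++ (P ++ U) → c ∈ C
    from = ↭P.Any-resp-↭ (↭.↭-sym C↭)
    P⊆C : ∀ {c} → c ∈ P → c ∈ C
    P⊆C c∈P = from (∈P.∈-++⁺ʳ (zeros ε) (∈P.∈-++⁺ˡ c∈P))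
    U⊆C : ∀ {c} → c ∈ U → c ∈ C
    U⊆C c∈U = from (∈P.∈-++⁺ʳ (zeros ε) (∈P.∈-++⁺ʳ P c∈U))
    nz : ∀ {c} → c ∈ P ++ U → NonZero c
    nz c∈P++U with ∈P.∈-++⁻ P c∈P++U
    ... | inj₁ c∈P = All.lookup nzP c∈P
    ... | inj₂ c∈U = All.lookup nzU c∈U

  unique : Unique C
  unique = Unique-resp-↭ (↭⇒↭ₛ (↭.↭-sym C↭)) (uZ ε)
    where
    uPU : Unique (P ++ U)
    uPU = UniqueP.++⁺ uP uU λ { (x∈P , x∈U) → P∩U _ x∈P x∈U }
    uZ : ∀ ε → Unique (zeros ε ++ (P ++ U))
    uZ false = uPU
    uZ true  = All.tabulate (λ x∈P++U 0≡x → nz x∈P++U (sym 0≡x)) ∷ uPU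

  -U∉C : ∀ {c} → c ∈ U → - c ∉ C
  -U∉C {c} c∈U -c∈C with ∈P.∈-++⁻ (zeros ε) (↭P.Any-resp-↭ C↭ -c∈C)
  ... | inj₁ -c∈zeros = All.lookup nzU c∈U (zero-only ε -c∈zeros)
    where
    zero-only : ∀ ε → - c ∈ zeros ε → c ≡ + 0
    zero-only true (here -c≡0) = trans (sym (ℤP.neg-involutive c)) (cong -_ -c≡0)
  ... | inj₂ -c∈P++U with ∈P.∈-++⁻ P -c∈P++U
  ...   | inj₁ -c∈P = P∩U c (subst (_∈ P) (ℤP.neg-involutive c) (symP (- c) -c∈P)) c∈U
  ...   | inj₂ -c∈U = negU c c∈U -c∈U

  sizeOf-parts : ∀ D → sizeOf C D ≡ 𝟙 ε * 𝟙 (onZero D) + (+ length P * 𝟙 (onPaired D) + + length U * 𝟙 (onUnpaired D))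
  sizeOf-parts D = begin
    ∑[ c ∈ C ] f c                                        ≡⟨ ∑-↭ f C↭ ⟩
    ∑[ c ∈ zeros ε ++ (P ++ U) ] f c                     ≡⟨ ∑-++ (zeros ε) (P ++ U) f ⟩
    ∑ (zeros ε) f + ∑ (P ++ U) f                         ≡⟨ cong₂ _+_ (zero-part ε refl) (∑-++ P U f) ⟩
    𝟙 ε * 𝟙 (onZero D) + (∑ P f + ∑ U f)                 ≡⟨ cong (λ e → 𝟙 ε * 𝟙 (onZero D) + e)
                                                             (cong₂ _+_ (∑-const-∈ P f _ paired) (∑-const-∈ U f _ unpaired)) ⟩
    𝟙 ε * 𝟙 (onZero D) + (+ length P * 𝟙 (onPaired D) + + length U * 𝟙 (onUnpaired D)) ∎
    where
    open ≡-Reasoning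
    f = λ c → 𝟙 (⟦ D ⟧ C c)
    zero-part : ∀ ε′ → ε′ ≡ ε → ∑ (zeros ε′) f ≡ 𝟙 ε′ * 𝟙 (onZero D)
    zero-part false _    = sym (ℤP.*-zeroˡ (𝟙 (onZero D)))
    zero-part true  refl rewrite ∈ᵇ-true (from (here refl)) = trans (ℤP.+-identityʳ _) (sym (ℤP.*-identityˡ _))
    nonzero⇒¬isZero : ∀ {c} → NonZero c → isZero c ≡ false
    nonzero⇒¬isZero {c} c≢0 = dec-false (c ℤ.≟ + 0) c≢0
    paired : ∀ c → c ∈ P → f c ≡ 𝟙 (onPaired D)
    paired c c∈P rewrite ∈ᵇ-true (P⊆C c∈P) | nonzero⇒¬isZero (All.lookup nzP c∈P) | ∈ᵇ-true (P⊆C (symP c c∈P)) = refl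
    unpaired : ∀ c → c ∈ U → f c ≡ 𝟙 (onUnpaired D)
    unpaired c c∈U rewrite ∈ᵇ-true (U⊆C c∈U) | nonzero⇒¬isZero (All.lookup nzU c∈U) | ∈ᵇ-false (-U∉C c∈U) = refl

  sizes : ∀ {λ′ μ} k → λ′ ≡ μ ℕ.+ (bit ε ℕ.+ 2 ℕ.* k) → length P ≡ 2 ℕ.* k → length U ≡ μ →
    ∀ D → sizeOf C D ≡ evalM (sizeM ε D) (+ λ′) (+ μ)
  sizes {λ′} {μ} k refl |P| refl D = begin
    sizeOf C D                                              ≡⟨ sizeOf-parts D ⟩
    𝟙 ε * 𝟙 z + (+ length P * 𝟙 p + + μ * 𝟙 u)
      ≡⟨ cong (λ l → 𝟙 ε * 𝟙 z + (+ l * 𝟙 p + + μ * 𝟙 u)) |P| ⟩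
    𝟙 ε * 𝟙 z + (+ (2 ℕ.* k) * 𝟙 p + + μ * 𝟙 u)           ≡⟨ solve 6 (λ e z p u m h → e :* z :+ (h :* p :+ m :* u)
                                                                  := z :* e :+ p :* (m :+ (e :+ h) :- m :- e) :+ u :* m)
                                                                refl (𝟙 ε) (𝟙 z) (𝟙 p) (𝟙 u) (+ μ) (+ (2 ℕ.* k)) ⟩
    𝟙 z * 𝟙 ε + 𝟙 p * (+ μ + (𝟙 ε + + (2 ℕ.* k)) - + μ - 𝟙 ε) + 𝟙 u * + μ
                                                            ≡⟨ cong (λ x → 𝟙 z * 𝟙 ε + 𝟙 p * (x - + μ - 𝟙 ε) + 𝟙 u * + μ) λ≡ ⟨
    𝟙 z * 𝟙 ε + 𝟙 p * (+ λ′ - + μ - 𝟙 ε) + 𝟙 u * + μ      ≡⟨ evalM-sizeM ε D (+ λ′) (+ μ) ⟨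
    evalM (sizeM ε D) (+ λ′) (+ μ)                          ∎
    where
    open ≡-Reasoning
    z = onZero D
    p = onPaired D
    u = onUnpaired D
    λ≡ : + λ′ ≡ + μ + (𝟙 ε + + (2 ℕ.* k))
    λ≡ = trans (ℤP.pos-+ μ _) (cong (λ e → + μ + e) (trans (ℤP.pos-+ (bit ε) _) (cong (_+ + (2 ℕ.* k)) (bit≡𝟙 ε))))
      where
      bit≡𝟙 : ∀ ε → + bit ε ≡ 𝟙 ε
      bit≡𝟙 false = refl
      bit≡𝟙 true  = refl

colourSetData : ∀ {λ′ μ C} → IsColourSet λ′ μ C → ColourSetData λ′ μ C
colourSetData {C = C} (P , U , uP , uU , nzP , nzU , symP , P∩U , |U| , negU , inj₁ (k , λ≡ , |P| , C↭)) =
  record { ε = false ; k = k ; λ≡ = λ≡ ; unique = unique ; sizes = sizes k λ≡ |P| |U| }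
  where open FromParts C P U false C↭ uP uU nzP nzU symP P∩U negU
colourSetData {C = C} (P , U , uP , uU , nzP , nzU , symP , P∩U , |U| , negU , inj₂ (k , λ≡ , |P| , C↭)) =
  record { ε = true ; k = k ; λ≡ = λ≡ ; unique = unique ; sizes = sizes k λ≡ |P| |U| }
  where open FromParts C P U true C↭ uP uU nzP nzU symP P∩U negU

parity : ∀ {μ} ε ε′ k k′ → μ ℕ.+ (bit ε ℕ.+ 2 ℕ.* k) ≡ μ ℕ.+ (bit ε′ ℕ.+ 2 ℕ.* k′) → ε ≡ ε′
parity     false false k k′ _ = refl
parity     true  true  k k′ _ = refl
parity {μ} false true  k k′ e = contradiction (ℕP.+-cancelˡ-≡ μ _ _ e) (ℕP.even≢odd k k′)
parity {μ} true  false k k′ e = contradiction (ℕP.+-cancelˡ-≡ μ _ _ (sym e)) (ℕP.even≢odd k′ k)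

ups : ℕ → ℕ → List ℤ
ups k = applyUpTo λ t → + suc (k ℕ.+ t)

canonical : Bool → ℕ → ℕ → List ℤ
canonical ε k μ = zeros ε ++ (pmList k ++ ups k μ)

pm-bound : ∀ {x} k → x ∈ pmList k → ∣ x ∣ ℕ.≤ k
pm-bound (suc k) (here refl)         = ℕP.≤-refl
pm-bound (suc k) (there (here refl)) = ℕP.≤-refl
pm-bound (suc k) (there (there x∈))  = ℕP.m≤n⇒m≤1+n (pm-bound k x∈)

pm-sym : ∀ k x → x ∈ pmList k → - x ∈ pmList k
pm-sym (suc k) x (here refl)         = there (here refl)
pm-sym (suc k) x (there (here refl)) = here refl
pm-sym (suc k) x (there (there x∈))  = there (there (pm-sym k x x∈))

pm-nonzero : ∀ k → All NonZero (pmList k)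
pm-nonzero zero    = []
pm-nonzero (suc k) = (λ ()) ∷ (λ ()) ∷ pm-nonzero k

pm-length : ∀ k → length (pmList k) ≡ 2 ℕ.* k
pm-length zero    = refl
pm-length (suc k) = trans (cong (λ l → suc (suc l)) (pm-length k)) (sym (ℕP.*-suc 2 k))

pm-unique : ∀ k → Unique (pmList k)
pm-unique zero    = []
pm-unique (suc k) = ((λ ()) ∷ All.tabulate (beyond (+ suc k) refl)) ∷ All.tabulate (beyond (- + suc k) refl) ∷ pm-unique k
  where
  beyond : ∀ y {x} → ∣ y ∣ ≡ suc k → x ∈ pmList k → y ≢ x
  beyond y {x} ∣y∣ x∈ refl = ℕP.1+n≰n (subst (ℕ._≤ k) ∣y∣ (pm-bound k x∈))

ups-∈ : ∀ {x} k μ → x ∈ ups k μ → Σ ℕ λ t → x ≡ + suc (k ℕ.+ t)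
ups-∈ k μ x∈ with ∈P.∈-applyUpTo⁻ (λ t → + suc (k ℕ.+ t)) x∈
... | t , _ , x≡ = t , x≡

isColourSet-canonical : ∀ ε k μ {C} → C ↭ canonical ε k μ → IsColourSet (μ ℕ.+ (bit ε ℕ.+ 2 ℕ.* k)) μ C
isColourSet-canonical ε k μ {C} C↭ =
  pmList k , ups k μ , pm-unique k , ups-unique , pm-nonzero k , All.tabulate ups-nonzero , pm-sym k , disjoint ,
  LP.length-applyUpTo _ μ , no-negatives , last ε C↭
  where
  ups-unique : Unique (ups k μ)
  ups-unique = UniqueP.applyUpTo⁺₁ _ μ λ i<j _ e → ℕP.<-irrefl (ℕP.+-cancelˡ-≡ k _ _ (ℕP.suc-injective (ℤP.+-injective e))) i<j
  ups-nonzero : ∀ {x} → x ∈ ups k μ → NonZero x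
  ups-nonzero x∈ refl with ups-∈ k μ x∈
  ... | t , ()
  disjoint : ∀ x → x ∈ pmList k → x ∉ ups k μ
  disjoint x x∈P x∈U with ups-∈ k μ x∈U
  ... | t , refl = ℕP.1+n≰n (ℕP.≤-trans (ℕ.s≤s (ℕP.m≤m+n k t)) (pm-bound k x∈P))
  no-negatives : ∀ x → x ∈ ups k μ → - x ∉ ups k μ
  no-negatives x x∈ -x∈ with ups-∈ k μ x∈ | ups-∈ k μ -x∈
  ... | t , refl | t′ , ()
  last : ∀ ε → C ↭ canonical ε k μ →
    (Σ ℕ λ k′ → μ ℕ.+ (bit ε ℕ.+ 2 ℕ.* k) ≡ μ ℕ.+ 2 ℕ.* k′ × length (pmList k) ≡ 2 ℕ.* k′ × C ↭ pmList k ++ ups k μ)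
    ⊎ (Σ ℕ λ k′ → μ ℕ.+ (bit ε ℕ.+ 2 ℕ.* k) ≡ μ ℕ.+ suc (2 ℕ.* k′) × length (pmList k) ≡ 2 ℕ.* k′ × C ↭ + 0 ∷ pmList k ++ ups k μ)
  last false C↭ = inj₁ (k , refl , pm-length k , C↭)
  last true  C↭ = inj₂ (k , refl , pm-length k , C↭)

private
  double : ℕ → ℕ
  double zero    = zero
  double (suc k) = suc (suc (double k))

  double≡2* : ∀ k → double k ≡ 2 ℕ.* k
  double≡2* zero    = refl
  double≡2* (suc k) = trans (cong (λ d → suc (suc d)) (double≡2* k)) (sym (ℕP.*-suc 2 k))

  pm-injective : ∀ h k → pmList h ≡ pmList k → h ≡ k
  pm-injective h k e = ℕP.*-cancelˡ-≡ h k 2 (trans (sym (pm-length h)) (trans (cong length e) (pm-length k)))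

  -- Cλ (m + 2) is computed from the parity and half of m, which the clauses below recover from Cλ m.
  step-even : ∀ b h k → (if b then pmList h else + 0 ∷ pmList h) ≡ pmList k →
    (if b then pmList (suc h) else + 0 ∷ pmList (suc h)) ≡ pmList (suc k)
  step-even true  h k       e = cong (pmList ∘′ suc) (pm-injective h k e)
  step-even false h zero    ()
  step-even false h (suc k) ()

  step-odd : ∀ b h k → (if b then pmList h else + 0 ∷ pmList h) ≡ + 0 ∷ pmList k →
    (if b then pmList (suc h) else + 0 ∷ pmList (suc h)) ≡ + 0 ∷ pmList (suc k)
  step-odd true  zero    k ()
  step-odd true  (suc h) k ()
  step-odd false h       k e = cong (λ h → + 0 ∷ pmList (suc h)) (pm-injective h k (cong (L.drop 1) e))

Cλ-even : ∀ k → Cλ (2 ℕ.* k) ≡ pmList k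
Cλ-even k = trans (cong Cλ (sym (double≡2* k))) (go k)
  where
  go : ∀ k → Cλ (double k) ≡ pmList k
  go zero    = refl
  go (suc k) = step-even _ _ k (go k)

Cλ-odd : ∀ k → Cλ (suc (2 ℕ.* k)) ≡ + 0 ∷ pmList k
Cλ-odd k = trans (cong (Cλ ∘′ suc) (sym (double≡2* k))) (go k)
  where
  go : ∀ k → Cλ (suc (double k)) ≡ + 0 ∷ pmList k
  go zero    = refl
  go (suc k) = step-odd _ _ k (go k)

isColourSet-upTo : ∀ k → Σ ℕ λ μ → IsColourSet k μ (L.map +_ (L.upTo k))
isColourSet-upTo zero    = 0 , isColourSet-canonical false 0 0 ↭.↭-refl
isColourSet-upTo (suc μ) = μ , subst (λ l → IsColourSet l μ (L.map +_ (L.upTo (suc μ)))) (ℕP.+-comm μ 1)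
  (isColourSet-canonical true 0 μ (↭.↭-reflexive (cong (+ 0 ∷_) (LP.map-applyUpTo suc +_ μ))))

-- Signed graphs as constraint systems

pairs-complete : ∀ n (i j : Fin n) → (i , j) ∈ pairs n
pairs-complete n i j =
  ∈P.∈-concatMap⁺ (λ i → L.map (i ,_) (allFin n)) (lose (∈P.∈-allFin i) (∈P.∈-map⁺ (i ,_) (∈P.∈-allFin j)))

private
  later : ∀ n → Fin n → List (Fin n × Fin n)
  later n i = L.map (i ,_) (filter (λ j → toℕ i ℕ.<? toℕ j) (allFin n))

pairs<-complete : ∀ n (i j : Fin n) → toℕ i ℕ.< toℕ j → (i , j) ∈ pairs< n
pairs<-complete n i j i<j =
  ∈P.∈-concatMap⁺ (later n) (lose (∈P.∈-allFin i) (∈P.∈-map⁺ (i ,_) (∈P.∈-filter⁺ (λ j → toℕ i ℕ.<? toℕ j) (∈P.∈-allFin j) i<j)))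

pairs<-ordered : ∀ n {p} → p ∈ pairs< n → toℕ (proj₁ p) ℕ.< toℕ (proj₂ p)
pairs<-ordered n p∈ with find (∈P.∈-concatMap⁻ (later n) {xs = allFin n} p∈)
... | i , _ , p∈later with ∈P.∈-map⁻ (i ,_) p∈later
... | j , j∈ , refl = proj₂ (∈P.∈-filter⁻ (λ j → toℕ i ℕ.<? toℕ j) {xs = allFin n} j∈)

pairs<-unique : ∀ n → Unique (pairs< n)
pairs<-unique n = UniqueP.concat⁺
  (AllP.map⁺ (All.tabulate λ {i} _ → UniqueP.map⁺ (cong proj₂) (UniqueP.filter⁺ _ (UniqueP.allFin⁺ n))))
  (AllPairsP.map⁺ (AllPairs.map disjoint (UniqueP.allFin⁺ n)))
  where
  disjoint : ∀ {i i′} → i ≢ i′ → ∀ {p} → ¬ (p ∈ later n i × p ∈ later n i′)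
  disjoint {i} {i′} i≢i′ (p∈ , p∈′) with ∈P.∈-map⁻ (i ,_) p∈ | ∈P.∈-map⁻ (i′ ,_) p∈′
  ... | _ , _ , refl | _ , _ , e = i≢i′ (cong proj₁ e)

isEdge : (S : SignedGraph) → Fin (n S) × Fin (n S) → Bool
isEdge S p = adj S (proj₁ p) (proj₂ p)

edge : (S : SignedGraph) → Fin (n S) × Fin (n S) → Constraint (n S)
edge S (i , j) = i , j , pos S i j

edgeList : (S : SignedGraph) → List (Constraint (n S))
edgeList S = L.map (edge S) (filterᵇ (isEdge S) (pairs< (n S)))

edges : (S : SignedGraph) → Vec (Constraint (n S)) (length (edgeList S))
edges S = V.fromList (edgeList S)

private
  ∈-edgeList⁻ : ∀ S {e} → e ∈ edgeList S →
    ∃ λ p → p ∈ pairs< (n S) × adj S (proj₁ p) (proj₂ p) ≡ true × e ≡ edge S p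
  ∈-edgeList⁻ S e∈ with ∈P.∈-map⁻ (edge S) e∈
  ... | p , p∈ , refl with ∈P.∈-filter⁻ (T? ∘ isEdge S) {xs = pairs< (n S)} p∈
  ... | p∈pairs , isEdge-p = p , p∈pairs , Equivalence.to BP.T-≡ isEdge-p , refl

length-edgeList : ∀ S → length (edgeList S) ≡ numEdges S
length-edgeList S = trans (LP.length-map (edge S) (filterᵇ (isEdge S) (pairs< (n S)))) (go (pairs< (n S)))
  where
  go : ∀ ps → length (filterᵇ (isEdge S) ps) ≡ count (isEdge S) ps
  go []       = refl
  go (p ∷ ps) with isEdge S p
  ... | true  = cong suc (go ps)
  ... | false = go ps

#negative-edges : ∀ S → #negative (edges S) ≡ numNegEdges S
#negative-edges S = go (pairs< (n S))
  where
  go : ∀ ps → #negative (V.fromList (L.map (edge S) (filterᵇ (isEdge S) ps)))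
              ≡ count (λ p → adj S (proj₁ p) (proj₂ p) ∧ not (pos S (proj₁ p) (proj₂ p))) ps
  go []       = refl
  go (p ∷ ps) with isEdge S p
  ... | false = go ps
  ... | true with pos S (proj₁ p) (proj₂ p)
  ...   | true  = go ps
  ...   | false = cong suc (go ps)

edges-simple : ∀ S → Simple (edges S)
edges-simple S = AllᵥP.fromList⁺ (All.tabulate ordered) , fromList-AllPairs unique
  where
  ordered : ∀ {e} → e ∈ edgeList S → Ordered e
  ordered e∈ with ∈-edgeList⁻ S e∈
  ... | p , p∈ , _ , refl = pairs<-ordered (n S) p∈
  unique : AllPairs (λ e e′ → ends e ≢ ends e′) (edgeList S)
  unique = AllPairsP.map⁺ (UniqueP.filter⁺ (T? ∘ isEdge S) (pairs<-unique (n S)))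
  fromList-AllPairs : ∀ {R : Constraint (n S) → Constraint (n S) → Set} {es} → AllPairs R es → AllPairsᵥ.AllPairs R (V.fromList es)
  fromList-AllPairs []           = []ᵥ
  fromList-AllPairs (r ∷ rs) = AllᵥP.fromList⁺ r ∷ᵥ fromList-AllPairs rs

edges-positive : ∀ S → AllPositive S → Positive (edges S)
edges-positive S all⁺ = AllᵥP.fromList⁺ (All.tabulate positive)
  where
  positive : ∀ {e} → e ∈ edgeList S → proj₂ (proj₂ e) ≡ true
  positive e∈ with ∈-edgeList⁻ S e∈
  ... | (i , j) , _ , adj≡true , refl = all⁺ i j adj≡true

private
  bool-ext : ∀ {a b : Bool} → (a ≡ true → b ≡ true) → (b ≡ true → a ≡ true) → a ≡ b
  bool-ext {false} {false} _   _   = refl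
  bool-ext {false} {true}  _   b⇒a = b⇒a refl
  bool-ext {true}  {false} a⇒b _   = sym (a⇒b refl)
  bool-ext {true}  {true}  _   _   = refl

  all≡true⁺ : ∀ {A : Set} (p : A → Bool) xs → (∀ {x} → x ∈ xs → p x ≡ true) → all p xs ≡ true
  all≡true⁺ p []       _  = refl
  all≡true⁺ p (x ∷ xs) px rewrite px (here refl) = all≡true⁺ p xs (px ∘ there)

  all≡true⁻ : ∀ {A : Set} (p : A → Bool) xs → all p xs ≡ true → ∀ {x} → x ∈ xs → p x ≡ true
  all≡true⁻ p (x ∷ xs) all≡ x∈ with p x in px
  all≡true⁻ p (x ∷ xs) all≡ (here refl) | true = px
  all≡true⁻ p (x ∷ xs) all≡ (there x∈) | true = all≡true⁻ p xs all≡ x∈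
  all≡true⁻ p (x ∷ xs) ()   x∈          | false

satisfies-sym : ∀ {n} (κ : Vec ℤ n) i j s → satisfies κ (j , i , s) ≡ satisfies κ (i , j , s)
satisfies-sym κ i j s =
  cong not (does-⇔ (mk⇔ flip flip′) (lookup κ j ℤ.≟ sgn s * lookup κ i) (lookup κ i ℤ.≟ sgn s * lookup κ j))
  where
  flip : lookup κ j ≡ sgn s * lookup κ i → lookup κ i ≡ sgn s * lookup κ j
  flip e = Equivalence.to (sgn-move s (lookup κ i) (lookup κ j)) (sym e)
  flip′ : lookup κ i ≡ sgn s * lookup κ j → lookup κ j ≡ sgn s * lookup κ i
  flip′ e = Equivalence.to (sgn-move s (lookup κ j) (lookup κ i)) (sym e)

Proper : (S : SignedGraph) → Vec ℤ (n S) → Set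
Proper S κ = ∀ i j → adj S i j ≡ true → satisfies κ (edge S (i , j)) ≡ true

properSigned⇔Proper : ∀ S κ → properSigned S κ ≡ true ⇔ Proper S κ
properSigned⇔Proper S κ = mk⇔
  (λ proper i j adj≡ → at i j adj≡ (all≡true⁻ _ (pairs (n S)) proper (pairs-complete (n S) i j)))
  (λ proper → all≡true⁺ _ (pairs (n S)) λ {p} _ → from (proj₁ p) (proj₂ p) (proper (proj₁ p) (proj₂ p)))
  where
  test : ∀ i j → Bool
  test i j = ⌊ lookup κ i ℤ.≟ sgn (pos S i j) * lookup κ j ⌋
  at : ∀ i j → adj S i j ≡ true → not (adj S i j) ∨ not (test i j) ≡ true → satisfies κ (edge S (i , j)) ≡ true
  at i j adj≡ ok rewrite adj≡ | isYes≗does (lookup κ i ℤ.≟ sgn (pos S i j) * lookup κ j) = ok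
  from : ∀ i j → (adj S i j ≡ true → satisfies κ (edge S (i , j)) ≡ true) → not (adj S i j) ∨ not (test i j) ≡ true
  from i j h with adj S i j
  ... | false = refl
  ... | true rewrite isYes≗does (lookup κ i ℤ.≟ sgn (pos S i j) * lookup κ j) = h refl

-- Each edge is listed once, as (i , j) with i < j; the constraint is symmetric in i and j.
edges⇔Proper : ∀ S κ → all (satisfies κ) (edgeList S) ≡ true ⇔ Proper S κ
edges⇔Proper S κ = mk⇔ to (λ proper → all≡true⁺ _ (edgeList S) (from proper))
  where
  from : Proper S κ → ∀ {e} → e ∈ edgeList S → satisfies κ e ≡ true
  from proper e∈ with ∈-edgeList⁻ S e∈
  ... | (i , j) , _ , adj≡ , refl = proper i j adj≡
  listed : all (satisfies κ) (edgeList S) ≡ true → ∀ {i j} → toℕ i ℕ.< toℕ j → adj S i j ≡ true →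
    satisfies κ (edge S (i , j)) ≡ true
  listed all≡ {i} {j} i<j adj≡ = all≡true⁻ _ (edgeList S) all≡
    (∈P.∈-map⁺ (edge S) (∈P.∈-filter⁺ (T? ∘ isEdge S) (pairs<-complete (n S) i j i<j) (Equivalence.from BP.T-≡ adj≡)))
  to : all (satisfies κ) (edgeList S) ≡ true → Proper S κ
  to all≡ i j adj≡ with ℕP.<-cmp (toℕ i) (toℕ j)
  ... | tri< i<j _ _ = listed all≡ i<j adj≡
  ... | tri≈ _ i≡j _ = contradiction (trans (sym adj≡) (subst (λ j → adj S i j ≡ false) (FP.toℕ-injective i≡j) (adj-irrefl S i))) λ ()
  ... | tri> _ _ j<i = begin
    satisfies κ (i , j , pos S i j)   ≡⟨ cong (λ s → satisfies κ (i , j , s)) (pos-sym S i j adj≡) ⟩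
    satisfies κ (i , j , pos S j i)   ≡⟨ satisfies-sym κ i j (pos S j i) ⟨
    satisfies κ (j , i , pos S j i)   ≡⟨ listed all≡ j<i (trans (adj-sym S j i) adj≡) ⟩
    true                              ∎
    where open ≡-Reasoning

satisfiesAll-edges : ∀ S κ → satisfiesAll (edges S) κ ≡ 𝟙 (properSigned S κ)
satisfiesAll-edges S κ = trans (go (edgeList S))
  (cong 𝟙 (bool-ext (Equivalence.from (properSigned⇔Proper S κ) ∘ Equivalence.to (edges⇔Proper S κ))
                    (Equivalence.from (edges⇔Proper S κ) ∘ Equivalence.to (properSigned⇔Proper S κ))))
  where
  go : ∀ es → satisfiesAll (V.fromList es) κ ≡ 𝟙 (all (satisfies κ) es)
  go []       = refl
  go (e ∷ es) = trans (cong (𝟙 (satisfies κ e) *_) (go es)) (sym (𝟙-∧ (satisfies κ e) _))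

-- The polynomials E, O and χ of a signed graph

private module CS = ColourSetData

+numColourings≡#proper : ∀ S C → + numColourings S C ≡ #proper C (λ _ → ⟦ full ⟧ C) (edges S)
+numColourings≡#proper S C =
  trans (+count-allMaps C (n S) (properSigned S)) (∑ᵛ-cong-∈ C (n S) λ κ κ∈C → begin
  𝟙 (properSigned S κ)                                         ≡⟨ satisfiesAll-edges S κ ⟨
  satisfiesAll (edges S) κ                                     ≡⟨ ℤP.*-identityˡ _ ⟨
  + 1 * satisfiesAll (edges S) κ
    ≡⟨ cong (_* satisfiesAll (edges S) κ) (weight-full κ κ∈C) ⟨
  weight (λ _ → ⟦ full ⟧ C) κ * satisfiesAll (edges S) κ       ∎)
  where
  open ≡-Reasoning
  ⟦full⟧ : ∀ {c} → c ∈ C → ⟦ full ⟧ C c ≡ true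
  ⟦full⟧ {c} c∈C rewrite ∈ᵇ-true c∈C with isZero c | - c ∈ᵇ C
  ... | true  | _     = refl
  ... | false | true  = refl
  ... | false | false = refl
  weight-full : ∀ {k} (κ : Vec ℤ k) → (∀ v → lookup κ v ∈ C) → weight (λ _ → ⟦ full ⟧ C) κ ≡ + 1
  weight-full []ᵥ      _   = refl
  weight-full (c ∷ᵥ κ) κ∈C rewrite ⟦full⟧ (κ∈C F.zero) =
    trans (ℤP.*-identityˡ _) (weight-full κ (λ v → κ∈C (F.suc v)))

colouringPoly : Bool → SignedGraph → Poly₂
colouringPoly ε S = toPoly₂ (colouringM ε (λ _ → full) (edges S))

+numColourings≡colouringPoly : ∀ S {λ′ μ C} (D : ColourSetData λ′ μ C) →
  + numColourings S C ≡ eval₂ (colouringPoly (CS.ε D) S) (+ λ′) (+ μ)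
+numColourings≡colouringPoly S {λ′} {μ} {C} D = begin
  + numColourings S C                                              ≡⟨ +numColourings≡#proper S C ⟩
  #proper C (λ _ → ⟦ full ⟧ C) (edges S)
    ≡⟨ #proper≡colouringM C (CS.unique D) (CS.ε D) (+ λ′) (+ μ) (CS.sizes D) (λ _ → full) (edges S) ⟩
  evalM (colouringM (CS.ε D) (λ _ → full) (edges S)) (+ λ′) (+ μ)
    ≡⟨ eval₂-toPoly₂ (colouringM (CS.ε D) (λ _ → full) (edges S)) (+ λ′) (+ μ) ⟨
  eval₂ (colouringPoly (CS.ε D) S) (+ λ′) (+ μ)                       ∎
  where open ≡-Reasoning

-- IsE₂ S is Interpolates false S and IsO₂ S is Interpolates true S.
Interpolates : Bool → SignedGraph → Poly₂ → Set
Interpolates ε S P = ∀ λ′ μ k C → λ′ ≡ μ ℕ.+ (bit ε ℕ.+ 2 ℕ.* k) → IsColourSet λ′ μ C →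
  + numColourings S C ≡ eval₂ P (+ λ′) (+ μ)

interpolates : ∀ ε S → Interpolates ε S (colouringPoly ε S)
interpolates ε S λ′ μ k C λ≡ C-colours =
  subst (λ ε → + numColourings S C ≡ eval₂ (colouringPoly ε S) (+ λ′) (+ μ))
        (parity {μ} (CS.ε D) ε (CS.k D) k (trans (sym (CS.λ≡ D)) λ≡))
        (+numColourings≡colouringPoly S D)
  where D = colourSetData C-colours

interpolates-unique : ∀ ε S P → Interpolates ε S P → P ≈₂ colouringPoly ε S
interpolates-unique ε S P hP = ≈₂-on-points P (colouringPoly ε S) (bit ε) λ μ k →
  trans (sym (hP (μ ℕ.+ (bit ε ℕ.+ 2 ℕ.* k)) μ k (canonical ε k μ) refl (canonical-colours μ k)))
        (interpolates ε S (μ ℕ.+ (bit ε ℕ.+ 2 ℕ.* k)) μ k (canonical ε k μ) refl (canonical-colours μ k))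
  where
  canonical-colours : ∀ μ k → IsColourSet (μ ℕ.+ (bit ε ℕ.+ 2 ℕ.* k)) μ (canonical ε k μ)
  canonical-colours μ k = isColourSet-canonical ε k μ ↭.↭-refl

leadingCoeffs : ∀ ε S → LeadingCoeffs S (colouringPoly ε S)
leadingCoeffs ε S = x-term , xy-term
  where
  M = colouringM ε (λ _ → full) (edges S)
  x-coefficient : ∀ {N m} (cs : Vec (Constraint N) m) → Simple cs → ∀ n′ → N ≡ suc n′ →
    coeffM (colouringM ε (λ _ → full) cs) n′ 0 ≡ - + m
  x-coefficient cs simple n′ refl = coeffM-colouringM-xⁿ⁻¹ ε (λ _ → full) cs (λ _ → refl) simple
  xy-coefficient : ∀ {N m} (cs : Vec (Constraint N) m) → Simple cs → ∀ n′ → N ≡ suc (suc n′) →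
    coeffM (colouringM ε (λ _ → full) cs) n′ 1 ≡ + #negative cs
  xy-coefficient cs simple n′ refl = coeffM-colouringM-xⁿ⁻²y ε (λ _ → full) cs (λ _ → refl) simple
  x-term : ∀ m → n S ≡ suc m → coeff₂ (colouringPoly ε S) m 0 ≡ - (+ numEdges S)
  x-term m n≡ = trans (coeff₂-toPoly₂ M m 0)
    (trans (x-coefficient (edges S) (edges-simple S) m n≡) (cong (λ l → - + l) (length-edgeList S)))
  xy-term : ∀ m → n S ≡ suc (suc m) → coeff₂ (colouringPoly ε S) m 1 ≡ + numNegEdges S
  xy-term m n≡ = trans (coeff₂-toPoly₂ M m 1)
    (trans (xy-coefficient (edges S) (edges-simple S) m n≡) (cong +_ (#negative-edges S)))

LeadingCoeffs-resp-≈₂ : ∀ S P Q → P ≈₂ Q → LeadingCoeffs S Q → LeadingCoeffs S P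
LeadingCoeffs-resp-≈₂ S P Q P≈Q (x , xy) =
  (λ m n≡ → trans (P≈Q m 0) (x m n≡)) , (λ m n≡ → trans (P≈Q m 1) (xy m n≡))

E₁ O₁ : SignedGraph → Poly₁
E₁ S = restrictY (colouringPoly false S) (+ 0)
O₁ S = restrictY (colouringPoly true S) (+ 0)

isE₁ : ∀ S → IsE₁ S (E₁ S)
isE₁ S k = begin
  + numColourings S (Cλ (2 ℕ.* k))                ≡⟨ cong (λ C → + numColourings S C) (Cλ-even k) ⟩
  + numColourings S (pmList k)
    ≡⟨ interpolates false S (2 ℕ.* k) 0 k (pmList k) refl colours ⟩
  eval₂ (colouringPoly false S) (+ (2 ℕ.* k)) (+ 0) ≡⟨ eval-restrictY (colouringPoly false S) _ _ ⟨
  eval₁ (E₁ S) (+ (2 ℕ.* k))                      ∎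
  where
  open ≡-Reasoning
  colours = isColourSet-canonical false k 0 (↭.↭-reflexive (sym (LP.++-identityʳ (pmList k))))

isO₁ : ∀ S → IsO₁ S (O₁ S)
isO₁ S k = begin
  + numColourings S (Cλ (suc (2 ℕ.* k)))                ≡⟨ cong (λ C → + numColourings S C) (Cλ-odd k) ⟩
  + numColourings S (+ 0 ∷ pmList k)
    ≡⟨ interpolates true S (suc (2 ℕ.* k)) 0 k (+ 0 ∷ pmList k) refl colours ⟩
  eval₂ (colouringPoly true S) (+ suc (2 ℕ.* k)) (+ 0)  ≡⟨ eval-restrictY (colouringPoly true S) _ _ ⟨
  eval₁ (O₁ S) (+ suc (2 ℕ.* k))                        ∎
  where
  open ≡-Reasoning
  colours = isColourSet-canonical true k 0 (↭.prep (+ 0) (↭.↭-reflexive (sym (LP.++-identityʳ (pmList k)))))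

allPositive-value : ∀ S → AllPositive S → ∀ {λ′ μ C} → IsColourSet λ′ μ C → + numColourings S C ≡ eval₁ (E₁ S) (+ λ′)
allPositive-value S all⁺ {λ′} {μ} {C} C-colours = begin
  + numColourings S C                                               ≡⟨ +numColourings≡colouringPoly S D ⟩
  eval₂ (colouringPoly (CS.ε D) S) (+ λ′) (+ μ)
    ≡⟨ eval₂-toPoly₂ (colouringM (CS.ε D) (λ _ → full) (edges S)) _ _ ⟩
  evalM (colouringM (CS.ε D) (λ _ → full) (edges S)) (+ λ′) (+ μ)
    ≡⟨ colouringM-positive (CS.ε D) false (λ _ → full) (edges S) (λ _ → refl) (edges-positive S all⁺) (+ λ′) (+ μ) (+ 0) ⟩
  evalM (colouringM false (λ _ → full) (edges S)) (+ λ′) (+ 0)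
    ≡⟨ eval₂-toPoly₂ (colouringM false (λ _ → full) (edges S)) _ _ ⟨
  eval₂ (colouringPoly false S) (+ λ′) (+ 0)
    ≡⟨ eval-restrictY (colouringPoly false S) _ _ ⟨
  eval₁ (E₁ S) (+ λ′)                                               ∎
  where
  open ≡-Reasoning
  D = colourSetData C-colours

allMaps-map : ∀ {A B : Set} (f : A → B) C n → allMaps (L.map f C) n ≡ L.map (V.map f) (allMaps C n)
allMaps-map f C zero    = refl
allMaps-map f C (suc n) = trans (cong (λ Ms → concatMap (λ c → L.map (c ∷ᵥ_) Ms) (L.map f C)) (allMaps-map f C n)) (go C)
  where
  go : ∀ D → concatMap (λ c → L.map (c ∷ᵥ_) (L.map (V.map f) (allMaps C n))) (L.map f D)
           ≡ L.map (V.map f) (concatMap (λ c → L.map (c ∷ᵥ_) (allMaps C n)) D)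
  go []      = refl
  go (c ∷ D) = trans (cong₂ _++_ (trans (sym (LP.map-∘ (allMaps C n))) (LP.map-∘ (allMaps C n))) (go D))
                     (sym (LP.map-++ (V.map f) (L.map (c ∷ᵥ_) (allMaps C n)) _))

allPositive-chromatic : ∀ S → AllPositive S → ∀ k → + numOrdColourings S k ≡ eval₁ (E₁ S) (+ k)
allPositive-chromatic S all⁺ k = begin
  + count (properOrd S) (allMaps (upTo k) (n S))
    ≡⟨ cong +_ (count-cong signed-as-ordinary (allMaps (upTo k) (n S))) ⟨
  + count (λ κ → properSigned S (V.map (+_) κ)) (allMaps (upTo k) (n S))
    ≡⟨ cong +_ (count-map (properSigned S) (V.map (+_)) (allMaps (upTo k) (n S))) ⟨
  + count (properSigned S) (L.map (V.map (+_)) (allMaps (upTo k) (n S)))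
    ≡⟨ cong (λ Ms → + count (properSigned S) Ms) (allMaps-map (+_) (upTo k) (n S)) ⟨
  + numColourings S (L.map (+_) (upTo k))
    ≡⟨ allPositive-value S all⁺ (proj₂ (isColourSet-upTo k)) ⟩
  eval₁ (E₁ S) (+ k)                                                          ∎
  where
  open ≡-Reasoning
  same-test : ∀ a b → ⌊ + a ℤ.≟ sgn true * + b ⌋ ≡ ⌊ a ℕ.≟ b ⌋
  same-test a b rewrite isYes≗does (+ a ℤ.≟ sgn true * + b) | isYes≗does (a ℕ.≟ b) =
    does-⇔ (mk⇔ (λ e → ℤP.+-injective (trans e (ℤP.*-identityˡ (+ b)))) (λ { refl → sym (ℤP.*-identityˡ (+ b)) }))
           (+ a ℤ.≟ sgn true * + b) (a ℕ.≟ b)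
  signed-as-ordinary : ∀ κ → properSigned S (V.map (+_) κ) ≡ properOrd S κ
  signed-as-ordinary κ = cong and (LP.map-cong pointwise (pairs (n S)))
    where
    pointwise : ∀ p → not (adj S (proj₁ p) (proj₂ p)) ∨
      not ⌊ lookup (V.map (+_) κ) (proj₁ p) ℤ.≟ sgn (pos S (proj₁ p) (proj₂ p)) * lookup (V.map (+_) κ) (proj₂ p) ⌋
        ≡ not (adj S (proj₁ p) (proj₂ p)) ∨ not ⌊ lookup κ (proj₁ p) ℕ.≟ lookup κ (proj₂ p) ⌋
    pointwise (i , j) with adj S i j in adj≡
    ... | false = refl
    ... | true rewrite all⁺ i j adj≡ | VP.lookup-map i (+_) κ | VP.lookup-map j (+_) κ =
      cong not (same-test (lookup κ i) (lookup κ j))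

positivePart : SignedGraph → SignedGraph
positivePart S = record
  { n = n S ; adj = adj S ; pos = λ _ _ → true
  ; adj-sym = adj-sym S ; adj-irrefl = adj-irrefl S ; pos-sym = λ _ _ _ → refl }

chromatic : SignedGraph → Poly₁
chromatic S = E₁ (positivePart S)

isChrom : ∀ S → IsChrom S (chromatic S)
isChrom S = allPositive-chromatic (positivePart S) (λ _ _ _ → refl)

eval₂-embed : ∀ Q x y → eval₂ (embed Q) x y ≡ eval₁ Q x
eval₂-embed []      x y = refl
eval₂-embed (c ∷ Q) x y =
  cong₂ _+_ (trans (cong (λ e → c + e) (ℤP.*-zeroʳ y)) (ℤP.+-identityʳ c)) (cong (x *_) (eval₂-embed Q x y))

embed-≈ : ∀ Q Q′ → Q ≈₁ Q′ → embed Q ≈₂ embed Q′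
embed-≈ Q Q′ Q≈Q′ i j = trans (coeff₂-embed Q i j) (trans (cong (δ 0 j) (Q≈Q′ i)) (sym (coeff₂-embed Q′ i j)))
  where
  coeff₂-embed : ∀ Q i j → coeff₂ (embed Q) i j ≡ δ 0 j (nth Q i)
  coeff₂-embed []      i       zero    = refl
  coeff₂-embed []      i       (suc j) = refl
  coeff₂-embed (c ∷ Q) zero    zero    = refl
  coeff₂-embed (c ∷ Q) zero    (suc j) = refl
  coeff₂-embed (c ∷ Q) (suc i) j       = coeff₂-embed Q i j

allPositive-agree : ∀ S → AllPositive S →
  ∀ PE PO QE QO X → IsE₂ S PE → IsO₂ S PO → IsE₁ S QE → IsO₁ S QO → IsChrom S X →
  (PE ≈₂ PO) × (PO ≈₂ embed QE) × (QE ≈₁ QO) × (QO ≈₁ X)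
allPositive-agree S all⁺ PE PO QE QO X hPE hPO hQE hQO hX =
  (λ i j → trans (PE≈χ i j) (sym (PO≈χ i j))) ,
  (λ i j → trans (PO≈χ i j) (embed-≈ χ QE (λ i → sym (QE≈χ i)) i j)) ,
  (λ i → trans (QE≈χ i) (sym (QO≈χ i))) ,
  (λ i → trans (QO≈χ i) (sym (X≈χ i)))
  where
  χ = E₁ S
  bivariate : ∀ ε P → Interpolates ε S P → P ≈₂ embed χ
  bivariate ε P hP = ≈₂-on-points P (embed χ) (bit ε) λ μ k →
    let colours = isColourSet-canonical ε k μ ↭.↭-refl in
    trans (sym (hP _ μ k (canonical ε k μ) refl colours))
          (trans (allPositive-value S all⁺ colours) (sym (eval₂-embed χ _ (+ μ))))
  PE≈χ = bivariate false PE hPE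
  PO≈χ = bivariate true PO hPO
  QE≈χ : QE ≈₁ χ
  QE≈χ = ≈₁-on-progression QE χ 0 2 (λ ()) λ k → trans (sym (hQE k))
    (trans (cong (λ C → + numColourings S C) (Cλ-even k))
           (allPositive-value S all⁺ (isColourSet-canonical false k 0 (↭.↭-reflexive (sym (LP.++-identityʳ (pmList k)))))))
  QO≈χ : QO ≈₁ χ
  QO≈χ = ≈₁-on-progression QO χ 1 2 (λ ()) λ k → trans (sym (hQO k))
    (trans (cong (λ C → + numColourings S C) (Cλ-odd k))
           (allPositive-value S all⁺ (isColourSet-canonical true k 0 (↭.prep (+ 0) (↭.↭-reflexive (sym (LP.++-identityʳ (pmList k))))))))
  X≈χ : X ≈₁ χ
  X≈χ = ≈₁-on-progression X χ 0 1 (λ ()) λ k →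
    subst (λ m → eval₁ X (+ m) ≡ eval₁ χ (+ m)) (sym (ℕP.*-identityˡ k))
      (trans (sym (hX k)) (allPositive-chromatic S all⁺ k))

corollary4p6 : (S : SignedGraph) →
    (Σ Poly₂ (IsE₂ S) × Σ Poly₂ (IsO₂ S) × Σ Poly₁ (IsE₁ S) × Σ Poly₁ (IsO₁ S) × Σ Poly₁ (IsChrom S)) ×
    (∀ P → IsE₂ S P → LeadingCoeffs S P) ×
    (∀ P → IsO₂ S P → LeadingCoeffs S P) ×
    (AllPositive S →
      ∀ PE PO QE QO X → IsE₂ S PE → IsO₂ S PO → IsE₁ S QE → IsO₁ S QO → IsChrom S X →
        (PE ≈₂ PO) × (PO ≈₂ embed QE) × (QE ≈₁ QO) × (QO ≈₁ X))
corollary4p6 S =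
  ( (colouringPoly false S , interpolates false S) , (colouringPoly true S , interpolates true S)
  , (E₁ S , isE₁ S) , (O₁ S , isO₁ S) , (chromatic S , isChrom S) ) ,
  (λ P hP → LeadingCoeffs-resp-≈₂ S P (colouringPoly false S) (interpolates-unique false S P hP) (leadingCoeffs false S)) ,
  (λ P hP → LeadingCoeffs-resp-≈₂ S P (colouringPoly true S) (interpolates-unique true S P hP) (leadingCoeffs true S)) ,
  allPositive-agree S
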